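{- For every $r\ge 2$, the glued binary tree $GT(r)$ satisfies $\mu_{\rm t}(GT(r))=\mu_{\rm d}(GT(r))=2^{r-1}$, and the number of $\mu_{\rm t}$-sets of $GT(r)$ and the number of $\mu_{\rm d}$-sets of $GT(r)$ are both equal to $2^{2^{r-1}}$.
   Context: A perfect binary tree of depth $r$ is a rooted tree in which every non-leaf vertex has exactly 2 children and all leaves have depth $r$. $GT(r)$ is obtained from two copies of it by identifying each leaf of the first copy with the corresponding leaf (under the natural isomorphism) of the second copy. For a graph $G$ and $S\subseteq V(G)$, two vertices $u,v$ are $S$-visible if there exists a shortest $u,v$-path $P$ with $V(P)\cap S\subseteq\{u,v\}$. $S$ is a mutual-visibility set if every two vertices of $S$ are $S$-visible; $S$ is a dual mutual-visibility set if it is a mutual-visibility set and every two vertices of $V(G)\setminus S$ are $S$-visible; $S$ is a total mutual-visibility set if every two vertices of $G$ are $S$-visible. $\mu_{\rm d}(G)$ and $\mu_{\rm t}(G)$ are the maximum sizes of a dual, respectively total, mutual-visibility set; $\mu_{\rm d}$-sets and $\mu_{\rm t}$-sets are such sets of maximum size. -}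

module Defs where

open import Data.Nat using (ℕ; zero; suc; _+_; _*_; _∸_; _^_; _≤_; _<_; _<ᵇ_)
open import Data.Bool using (if_then_else_)
open import Data.Fin using (Fin; toℕ)
open import Data.Fin.Subset using (Subset; _∈_; _∉_; ∣_∣)
open import Data.List using (List; []; _∷_; length)
import Data.List.Membership.Propositional as LM
open import Data.List.Relation.Unary.Unique.Propositional using (Unique)
open import Data.Product using (Σ; _×_; ∃; ∃-syntax)
open import Data.Sum using (_⊎_)
open import Relation.Binary.PropositionalEquality using (_≡_)
open import Function.Bundles using (_⇔_)

module _ {n : ℕ} (Adj : Fin n → Fin n → Set) where

  data Walk : Fin n → Fin n → Set where
    [] : ∀ {u} → Walk u u
    _∷_ : ∀ {u w v} → Adj u w → Walk w v → Walk u v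

  len : ∀ {u v} → Walk u v → ℕ
  len [] = 0
  len (_ ∷ p) = suc (len p)

  verts : ∀ {u v} → Walk u v → List (Fin n)
  verts {u} [] = u ∷ []
  verts {u} (_ ∷ p) = u ∷ verts p

  -- a shortest u,v-path: no u,v-walk is shorter
  -- (a shortest walk is automatically a path)
  IsShortest : ∀ {u v} → Walk u v → Set
  IsShortest {u} {v} P = (Q : Walk u v) → len P ≤ len Q

  Visible : Subset n → Fin n → Fin n → Set
  Visible S u v = Σ (Walk u v) λ P → IsShortest P ×
    ((x : Fin n) → x LM.∈ verts P → x ∈ S → (x ≡ u ⊎ x ≡ v))

  IsMutualVisibility : Subset n → Set
  IsMutualVisibility S = ∀ u v → u ∈ S → v ∈ S → Visible S u v

  IsDualMutualVisibility : Subset n → Set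
  IsDualMutualVisibility S = IsMutualVisibility S ×
    (∀ u v → u ∉ S → v ∉ S → Visible S u v)

  IsTotalMutualVisibility : Subset n → Set
  IsTotalMutualVisibility S = ∀ u v → Visible S u v

module _ {n : ℕ} where

  IsMaxSize : (Subset n → Set) → ℕ → Set
  IsMaxSize P k = (Σ (Subset n) λ S → P S × ∣ S ∣ ≡ k) ×
                  (∀ S → P S → ∣ S ∣ ≤ k)

  IsMaxSet : (Subset n → Set) → Subset n → Set
  IsMaxSet P S = P S × (∀ T → P T → ∣ T ∣ ≤ ∣ S ∣)

  HasCount : (Subset n → Set) → ℕ → Set
  HasCount Q k = Σ (List (Subset n)) λ L → Unique L ×
    (∀ S → (S LM.∈ L) ⇔ Q S) × length L ≡ k

-- Each perfect binary tree of depth r is indexed in heap order: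
-- the root has index 1, the children of h are 2h and 2h+1; the
-- leaves are the indices 2^r ≤ h < 2^(r+1).
-- Vertices of GT(r) are Fin (3·2^r − 2):
--   * copy A vertex with heap index h (1 ≤ h < 2^(r+1)) is  h − 1;
--   * copy B internal vertex with heap index h (1 ≤ h < 2^r) is
--     2^(r+1) − 1 + (h − 1);
--   * copy B leaf with heap index h is identified with copy A leaf h.

GTsize : ℕ → ℕ
GTsize r = 3 * 2 ^ r ∸ 2

aVert : ℕ → ℕ → ℕ
aVert r h = h ∸ 1

bVert : ℕ → ℕ → ℕ
bVert r h = if h <ᵇ 2 ^ r then 2 ^ (r + 1) ∸ 1 + (h ∸ 1) else h ∸ 1

TreeEdge : ℕ → (ℕ → ℕ) → ℕ → ℕ → Set
TreeEdge r f m k = Σ ℕ λ h → 1 ≤ h × h < 2 ^ r × Σ ℕ λ c →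
  (c ≡ 2 * h ⊎ c ≡ 2 * h + 1) ×
  ((m ≡ f h × k ≡ f c) ⊎ (m ≡ f c × k ≡ f h))

GTAdj : (r : ℕ) → Fin (GTsize r) → Fin (GTsize r) → Set
GTAdj r x y = TreeEdge r (aVert r) (toℕ x) (toℕ y) ⊎
              TreeEdge r (bVert r) (toℕ x) (toℕ y)

module Submission where

-- The leaves of GT(r) come in M = 2^(r-1) sibling pairs, and the two copies of the parent of a
-- pair are the only common neighbours of its two leaves. Call a set that contains exactly one
-- leaf of each pair and nothing else a leaf transversal; there are 2^M of them, each of size M.
--
-- Every leaf transversal T is a total mutual-visibility set: a leaf of T inside a shortest path
-- can be replaced by its sibling, which has the same neighbours and is not in T.
--
-- Conversely, let S be a dual mutual-visibility set. If x ∈ S is the unique common neighbour of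
-- two non-adjacent vertices y and z, then exactly one of y, z lies in S, for otherwise y and z
-- would not be S-visible. For an internal vertex x whose children are internal, these constraints
-- on its parent and its two children form an odd cycle, so x ∉ S; the root and the parents of
-- leaves are excluded by a similar argument with paths of length 3. Once no internal vertex is
-- in S, the two leaves of a pair cannot both be in S, as they would separate the two copies of
-- their parent. So S lies inside a leaf transversal, which gives the bound M and shows that the
-- maximum dual and the maximum total mutual-visibility sets are exactly the leaf transversals.

open import Defs
open import Data.Bool using (Bool; true; false; not; if_then_else_; T)
open import Data.Bool.Properties using (not-involutive)
open import Data.Empty using (⊥; ⊥-elim)
open import Data.Fin using (Fin; toℕ; fromℕ<) renaming (_≟_ to _≟ᶠ_)
import Data.Fin as Fin
open import Data.Fin.Properties using (any?; toℕ-injective; toℕ-fromℕ<; toℕ<n)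
open import Data.Fin.Subset using (Subset; _∈_; _∉_; _⊆_; ∣_∣; inside; outside) renaming (⊥ to ∅)
open import Data.Fin.Subset.Properties using (_∈?_; p⊆q⇒∣p∣≤∣q∣; drop-∷-⊆)
open import Data.List using (List; []; _∷_; _++_; length; map)
open import Data.List.Properties using (length-map; length-++)
open import Data.List.Membership.Propositional using () renaming (_∈_ to _∈ˡ_)
open import Data.List.Membership.Propositional.Properties using (∈-map⁺; ∈-map⁻; ∈-++⁺ˡ; ∈-++⁺ʳ)
open import Data.List.Relation.Unary.All using ([])
open import Data.List.Relation.Unary.AllPairs using ([]; _∷_)
open import Data.List.Relation.Unary.Any using (here; there)
open import Data.List.Relation.Unary.Unique.Propositional using (Unique)
import Data.List.Relation.Unary.Unique.Propositional.Properties as Unique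
open import Data.Nat
open import Data.Nat.Induction using (<-wellFounded)
open import Data.Nat.Properties
open import Data.Nat.Solver using (module +-*-Solver)
open import Data.Product using (Σ; ∃; _×_; _,_; proj₁; proj₂; swap)
open import Data.Sum using (_⊎_; inj₁; inj₂)
import Data.Sum as Sum
open import Data.Unit using (tt)
open import Data.Vec using (Vec; []; _∷_; lookup; tabulate)
open import Data.Vec.Properties using (∷-injectiveʳ; []=⇒lookup; lookup⇒[]=; tabulate-cong; tabulate∘lookup)
open import Function using (_∘_)
open import Function.Bundles using (mk⇔)
open import Function.Definitions using (Injective)
open import Induction.WellFounded using (Acc; acc)
open import Relation.Binary.Definitions using (Decidable; Symmetric)
open import Relation.Binary.PropositionalEquality
open import Relation.Nullary using (¬_; Dec; yes; no)
open import Relation.Nullary.Decidable using (_×-dec_; _⊎-dec_; map′)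

-- Visibility in graphs on Fin n

ExactlyOneOf : ∀ {n} → Subset n → Fin n → Fin n → Set
ExactlyOneOf S y z = (y ∈ S → z ∉ S) × (y ∉ S → z ∈ S)

module WalkProperties {n : ℕ} (Adj : Fin n → Fin n → Set) where

  _++ʷ_ : ∀ {u v w} → Walk Adj u v → Walk Adj v w → Walk Adj u w
  [] ++ʷ q = q
  (e ∷ p) ++ʷ q = e ∷ (p ++ʷ q)

  reverseʷ : Symmetric Adj → ∀ {u v} → Walk Adj u v → Walk Adj v u
  reverseʷ sym [] = []
  reverseʷ sym (e ∷ p) = reverseʷ sym p ++ʷ (sym e ∷ [])

  isShortest-tail : ∀ {u w v} (e : Adj u w) (p : Walk Adj w v) →
                    IsShortest Adj (e ∷ p) → IsShortest Adj p
  isShortest-tail e p shortest q = ≤-pred (shortest (e ∷ q))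

  suffix : ∀ {u v x} (p : Walk Adj u v) → x ∈ˡ verts Adj p →
           Σ (Walk Adj x v) λ q → len Adj q ≤ len Adj p
  suffix []      (here refl) = [] , z≤n
  suffix (e ∷ p) (here refl) = e ∷ p , ≤-refl
  suffix (e ∷ p) (there x∈p) with suffix p x∈p
  ... | q , q≤p = q , m≤n⇒m≤1+n q≤p

  isShortest-start∉tail : ∀ {u w v} (e : Adj u w) (p : Walk Adj w v) →
                          IsShortest Adj (e ∷ p) → ¬ u ∈ˡ verts Adj p
  isShortest-start∉tail e p shortest u∈p with suffix p u∈p
  ... | q , q≤p = <⇒≱ (s≤s q≤p) (shortest q)

  InteriorAvoids : Subset n → ∀ {u v} → Walk Adj u v → Set
  InteriorAvoids S {u} {v} p = ∀ x → x ∈ˡ verts Adj p → x ∈ S → x ≡ u ⊎ x ≡ v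

  record UniqueMidpoint (y x z : Fin n) : Set where
    field
      ends-distinct : y ≢ z
      ends-nonadjacent : ¬ Adj y z
      first-edge : Adj y x
      second-edge : Adj x z
      unique : ∀ w → Adj y w → Adj w z → w ≡ x

  module Blocking (irrefl : ∀ {x} → ¬ Adj x x) (S : Subset n) where

    private
      no-avoiding-walk≤2 : ∀ {y z} → y ≢ z → ¬ Adj y z → (∀ w → Adj y w → Adj w z → w ∈ S) →
               (p : Walk Adj y z) → len Adj p ≤ 2 → ¬ InteriorAvoids S p
      no-avoiding-walk≤2 y≢z _ _ [] _ _ = y≢z refl
      no-avoiding-walk≤2 _ ¬yz _ (e ∷ []) _ _ = ¬yz e
      no-avoiding-walk≤2 _ ¬yz blocked (_∷_ {w = w} e₁ (e₂ ∷ [])) _ avoids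
        with avoids w (there (here refl)) (blocked w e₁ e₂)
      ... | inj₁ refl = irrefl e₁
      ... | inj₂ refl = ¬yz e₁
      no-avoiding-walk≤2 _ _ _ (_ ∷ _ ∷ _ ∷ _) (s≤s (s≤s ())) _

      no-avoiding-walk≤3 : ∀ {y z} → y ≢ z → ¬ Adj y z → (∀ w → Adj y w → ¬ Adj w z) →
               (∀ w₁ w₂ → Adj y w₁ → Adj w₁ w₂ → Adj w₂ z → w₁ ∈ S ⊎ w₂ ∈ S) →
               (p : Walk Adj y z) → len Adj p ≤ 3 → ¬ InteriorAvoids S p
      no-avoiding-walk≤3 y≢z _ _ _ [] _ _ = y≢z refl
      no-avoiding-walk≤3 _ ¬yz _ _ (e ∷ []) _ _ = ¬yz e
      no-avoiding-walk≤3 _ _ ¬dist2 _ (e₁ ∷ e₂ ∷ []) _ _ = ¬dist2 _ e₁ e₂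
      no-avoiding-walk≤3 _ ¬yz _ blocked (_∷_ {w = w₁} e₁ (_∷_ {w = w₂} e₂ (e₃ ∷ []))) _ avoids
        with blocked w₁ w₂ e₁ e₂ e₃
      ... | inj₁ w₁∈S with avoids w₁ (there (here refl)) w₁∈S
      ...   | inj₁ refl = irrefl e₁
      ...   | inj₂ refl = ¬yz e₁
      no-avoiding-walk≤3 _ ¬yz _ blocked (_∷_ {w = w₁} e₁ (_∷_ {w = w₂} e₂ (e₃ ∷ []))) _ avoids
        | inj₂ w₂∈S with avoids w₂ (there (there (here refl))) w₂∈S
      ...   | inj₁ refl = ¬yz e₃
      ...   | inj₂ refl = irrefl e₃
      no-avoiding-walk≤3 _ _ _ _ (_ ∷ _ ∷ _ ∷ _ ∷ _) (s≤s (s≤s (s≤s ()))) _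

    blocked-distance₂⇒¬visible : ∀ {y x z} → y ≢ z → ¬ Adj y z → Adj y x → Adj x z →
      (∀ w → Adj y w → Adj w z → w ∈ S) → ¬ Visible Adj S y z
    blocked-distance₂⇒¬visible y≢z ¬yz e₁ e₂ blocked (p , shortest , avoids) =
      no-avoiding-walk≤2 y≢z ¬yz blocked p (shortest (e₁ ∷ e₂ ∷ [])) avoids

    blocked-distance₃⇒¬visible : ∀ {y w₁ w₂ z} → y ≢ z → ¬ Adj y z →
      (∀ w → Adj y w → ¬ Adj w z) →
      (∀ w₁ w₂ → Adj y w₁ → Adj w₁ w₂ → Adj w₂ z → w₁ ∈ S ⊎ w₂ ∈ S) →
      Adj y w₁ → Adj w₁ w₂ → Adj w₂ z → ¬ Visible Adj S y z
    blocked-distance₃⇒¬visible y≢z ¬yz ¬dist2 blocked e₁ e₂ e₃ (p , shortest , avoids) =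
      no-avoiding-walk≤3 y≢z ¬yz ¬dist2 blocked p (shortest (e₁ ∷ e₂ ∷ e₃ ∷ [])) avoids

    midpoint∈dual⇒exactlyOneEnd : ∀ {y x z} → IsDualMutualVisibility Adj S →
      UniqueMidpoint y x z → x ∈ S → ExactlyOneOf S y z
    midpoint∈dual⇒exactlyOneEnd {y} {x} {z} (inS , outS) mid x∈S = both , neither
      where
      open UniqueMidpoint mid
      ¬visible : ¬ Visible Adj S y z
      ¬visible = blocked-distance₂⇒¬visible ends-distinct ends-nonadjacent first-edge second-edge
                   (λ w e₁ e₂ → subst (_∈ S) (sym (unique w e₁ e₂)) x∈S)
      both : y ∈ S → z ∉ S
      both y∈S z∈S = ¬visible (inS y z y∈S z∈S)
      neither : y ∉ S → z ∈ S
      neither y∉S with z ∈? S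
      ... | yes z∈S = z∈S
      ... | no z∉S = ⊥-elim (¬visible (outS y z y∉S z∉S))

  module ShortestWalks (adj? : Decidable Adj) where

    private
      ShortestWithin : ℕ → Fin n → Fin n → Set
      ShortestWithin d u v = (Σ (Walk Adj u v) λ p → IsShortest Adj p × len Adj p ≤ d)
                           ⊎ (∀ (q : Walk Adj u v) → d < len Adj q)

      search : ∀ d u v → ShortestWithin d u v
      search zero u v with u ≟ᶠ v
      ... | yes refl = inj₁ ([] , (λ _ → z≤n) , z≤n)
      ... | no u≢v = inj₂ λ { [] → ⊥-elim (u≢v refl) ; (_ ∷ _) → s≤s z≤n }
      search (suc d) u v with search d u v
      ... | inj₁ (p , shortest , p≤d) = inj₁ (p , shortest , m≤n⇒m≤1+n p≤d)
      ... | inj₂ far with any? step?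
        where
        Step : Fin n → Set
        Step w = Adj u w × Σ (Walk Adj w v) λ p → IsShortest Adj p × len Adj p ≤ d
        step? : ∀ w → Dec (Step w)
        step? w with adj? u w | search d w v
        ... | yes e | inj₁ p = yes (e , p)
        ... | no ¬e | _ = no (¬e ∘ proj₁)
        ... | _ | inj₂ far′ = no λ { (_ , p , _ , p≤d) → <⇒≱ (far′ p) p≤d }
      ... | yes (w , e , p , _ , p≤d) =
        inj₁ (e ∷ p , (λ q → ≤-trans (s≤s p≤d) (far q)) , s≤s p≤d)
      ... | no ¬step = inj₂ beyond
        where
        beyond : (q : Walk Adj u v) → suc d < len Adj q
        beyond [] = ⊥-elim (<⇒≱ (far []) z≤n)
        beyond (_∷_ {w = w} e q) with search d w v
        ... | inj₁ (p , shortest , p≤d) = ⊥-elim (¬step (w , e , p , shortest , p≤d))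
        ... | inj₂ far′ = s≤s (far′ q)

    shortestWalk : ∀ {u v} → Walk Adj u v → Σ (Walk Adj u v) (IsShortest Adj)
    shortestWalk {u} {v} p with search (len Adj p) u v
    ... | inj₁ (q , shortest , _) = q , shortest
    ... | inj₂ far = ⊥-elim (<-irrefl refl (far p))

  Bypassable : Subset n → Set
  Bypassable S = ∀ {u w x} → Adj u w → Adj w x → u ≢ x → w ∈ S →
                 Σ (Fin n) λ w′ → Adj u w′ × Adj w′ x × w′ ∉ S

  module _ {S : Subset n} (bypass : Bypassable S) where

    private
      prepend : ∀ {u w v} (e : Adj u w) (q : Walk Adj w v) → IsShortest Adj (e ∷ q) →
                InteriorAvoids S q → Σ (Walk Adj u v) λ p → len Adj p ≡ suc (len Adj q) × InteriorAvoids S p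
      prepend e [] _ _ = e ∷ [] , refl , λ where
        _ (here refl) _ → inj₁ refl
        _ (there (here refl)) _ → inj₂ refl
      prepend {u} {w} e (_∷_ {w = x} e₂ q) shortest avoids with w ∈? S
      ... | no w∉S = e ∷ e₂ ∷ q , refl , avoids′
        where
        avoids′ : InteriorAvoids S (e ∷ e₂ ∷ q)
        avoids′ _ (here refl) _ = inj₁ refl
        avoids′ y (there y∈q) y∈S with avoids y y∈q y∈S
        ... | inj₁ refl = ⊥-elim (w∉S y∈S)
        ... | inj₂ y≡v = inj₂ y≡v
      ... | yes w∈S with bypass e e₂ u≢x w∈S
        where
        u≢x : u ≢ x
        u≢x refl = <⇒≱ (s≤s (n≤1+n _)) (shortest q)
      ... | w′ , e₁′ , e₂′ , w′∉S = e₁′ ∷ e₂′ ∷ q , refl , avoids′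
        where
        avoids′ : InteriorAvoids S (e₁′ ∷ e₂′ ∷ q)
        avoids′ _ (here refl) _ = inj₁ refl
        avoids′ _ (there (here refl)) w′∈S = ⊥-elim (w′∉S w′∈S)
        avoids′ y (there (there y∈q)) y∈S with avoids y (there y∈q) y∈S
        ... | inj₁ refl = ⊥-elim (isShortest-start∉tail e₂ q (isShortest-tail e (e₂ ∷ q) shortest) y∈q)
        ... | inj₂ y≡v = inj₂ y≡v

      reroute : ∀ {u v} (p : Walk Adj u v) → IsShortest Adj p →
                Σ (Walk Adj u v) λ q → len Adj q ≡ len Adj p × InteriorAvoids S q
      reroute [] _ = [] , refl , λ { _ (here refl) _ → inj₁ refl }
      reroute (e ∷ p) shortest with reroute p (isShortest-tail e p shortest)
      ... | q , q≡p , avoids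
        with prepend e q (λ o → subst (_≤ len Adj o) (cong suc (sym q≡p)) (shortest o)) avoids
      ... | q′ , q′≡ , avoids′ = q′ , trans q′≡ (cong suc q≡p) , avoids′

    bypassable-isShortest⇒visible : ∀ {u v} (p : Walk Adj u v) → IsShortest Adj p → Visible Adj S u v
    bypassable-isShortest⇒visible p shortest with reroute p shortest
    ... | q , q≡p , avoids = q , (λ o → subst (_≤ len Adj o) (sym q≡p) (shortest o)) , avoids

  bypassable⇒totalMutualVisibility : Decidable Adj → (∀ u v → Walk Adj u v) →
    ∀ {S} → Bypassable S → IsTotalMutualVisibility Adj S
  bypassable⇒totalMutualVisibility adj? connected bypass u v =
    let p , shortest = ShortestWalks.shortestWalk adj? (connected u v)
    in bypassable-isShortest⇒visible bypass p shortest

  total⇒dual : ∀ {S} → IsTotalMutualVisibility Adj S → IsDualMutualVisibility Adj S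
  total⇒dual total = (λ u v _ _ → total u v) , (λ u v _ _ → total u v)

-- Counting maximum sets

allSubsets : ∀ m → List (Subset m)
allSubsets zero = [] ∷ []
allSubsets (suc m) = map (inside ∷_) (allSubsets m) ++ map (outside ∷_) (allSubsets m)

length-allSubsets : ∀ m → length (allSubsets m) ≡ 2 ^ m
length-allSubsets zero = refl
length-allSubsets (suc m) = begin
  length (map (inside ∷_) ps ++ map (outside ∷_) ps)             ≡⟨ length-++ (map (inside ∷_) ps) ⟩
  length (map (inside ∷_) ps) + length (map (outside ∷_) ps)     ≡⟨ cong₂ _+_ (length-map _ ps) (length-map _ ps) ⟩
  length ps + length ps                                          ≡⟨ cong₂ _+_ (length-allSubsets m) (length-allSubsets m) ⟩
  2 ^ m + 2 ^ m                                                  ≡⟨ cong (2 ^ m +_) (sym (+-identityʳ (2 ^ m))) ⟩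
  2 ^ suc m                                                      ∎
  where
  open ≡-Reasoning
  ps = allSubsets m

allSubsets-unique : ∀ m → Unique (allSubsets m)
allSubsets-unique zero = [] ∷ []
allSubsets-unique (suc m) =
  Unique.++⁺ (Unique.map⁺ ∷-injectiveʳ (allSubsets-unique m))
             (Unique.map⁺ ∷-injectiveʳ (allSubsets-unique m)) disjoint
  where
  disjoint : ∀ {p} → ¬ (p ∈ˡ map (inside ∷_) (allSubsets m) × p ∈ˡ map (outside ∷_) (allSubsets m))
  disjoint (p∈ins , p∈outs) with ∈-map⁻ (inside ∷_) p∈ins | ∈-map⁻ (outside ∷_) p∈outs
  ... | _ , _ , refl | _ , _ , ()

∈-allSubsets : ∀ {m} (p : Subset m) → p ∈ˡ allSubsets m
∈-allSubsets [] = here refl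
∈-allSubsets (inside ∷ p) = ∈-++⁺ˡ (∈-map⁺ (inside ∷_) (∈-allSubsets p))
∈-allSubsets {suc m} (outside ∷ p) = ∈-++⁺ʳ (map (inside ∷_) (allSubsets m)) (∈-map⁺ (outside ∷_) (∈-allSubsets p))

p⊆q∧∣q∣≤∣p∣⇒p≡q : ∀ {m} {p q : Subset m} → p ⊆ q → ∣ q ∣ ≤ ∣ p ∣ → p ≡ q
p⊆q∧∣q∣≤∣p∣⇒p≡q {p = []} {[]} _ _ = refl
p⊆q∧∣q∣≤∣p∣⇒p≡q {p = inside ∷ p} {inside ∷ q} p⊆q q≤p =
  cong (inside ∷_) (p⊆q∧∣q∣≤∣p∣⇒p≡q (drop-∷-⊆ p⊆q) (≤-pred q≤p))
p⊆q∧∣q∣≤∣p∣⇒p≡q {p = inside ∷ p} {outside ∷ q} p⊆q _ with p⊆q Data.Vec.here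
... | ()
p⊆q∧∣q∣≤∣p∣⇒p≡q {p = outside ∷ p} {outside ∷ q} p⊆q q≤p =
  cong (outside ∷_) (p⊆q∧∣q∣≤∣p∣⇒p≡q (drop-∷-⊆ p⊆q) q≤p)
p⊆q∧∣q∣≤∣p∣⇒p≡q {p = outside ∷ p} {inside ∷ q} p⊆q q≤p =
  ⊥-elim (<⇒≱ q≤p (p⊆q⇒∣p∣≤∣q∣ (drop-∷-⊆ p⊆q)))

module MaximumSets {n m c : ℕ} (P : Subset n → Set) (family : Subset m → Subset n)
  (family-injective : Injective _≡_ _≡_ family)
  (P-family : ∀ f → P (family f))
  (∣family∣≡c : ∀ f → ∣ family f ∣ ≡ c)
  (⊆-family : ∀ S → P S → Σ (Subset m) λ f → S ⊆ family f) where

  ∣P∣≤c : ∀ S → P S → ∣ S ∣ ≤ c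
  ∣P∣≤c S PS = let f , S⊆f = ⊆-family S PS in
    ≤-trans (p⊆q⇒∣p∣≤∣q∣ S⊆f) (≤-reflexive (∣family∣≡c f))

  isMaxSize : IsMaxSize P c
  isMaxSize = (family ∅ , P-family ∅ , ∣family∣≡c ∅) , ∣P∣≤c

  isMaxSet⇒∈family : ∀ S → IsMaxSet P S → S ∈ˡ map family (allSubsets m)
  isMaxSet⇒∈family S (PS , maximal) = subst (_∈ˡ map family (allSubsets m)) (sym S≡f) (∈-map⁺ family (∈-allSubsets f))
    where
    f = proj₁ (⊆-family S PS)
    S≡f : S ≡ family f
    S≡f = p⊆q∧∣q∣≤∣p∣⇒p≡q (proj₂ (⊆-family S PS))
            (subst (_≤ ∣ S ∣) (trans (∣family∣≡c ∅) (sym (∣family∣≡c f))) (maximal (family ∅) (P-family ∅)))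

  ∈family⇒isMaxSet : ∀ S → S ∈ˡ map family (allSubsets m) → IsMaxSet P S
  ∈family⇒isMaxSet S S∈ with ∈-map⁻ family S∈
  ... | f , _ , refl = P-family f , λ T PT → ≤-trans (∣P∣≤c T PT) (≤-reflexive (sym (∣family∣≡c f)))

  maxSetCount : HasCount (IsMaxSet P) (2 ^ m)
  maxSetCount = map family (allSubsets m)
              , Unique.map⁺ family-injective (allSubsets-unique m)
              , (λ S → mk⇔ (∈family⇒isMaxSet S) (isMaxSet⇒∈family S))
              , trans (length-map family (allSubsets m)) (length-allSubsets m)

-- Heap order

data Parent (p c : ℕ) : Set where
  left : c ≡ 2 * p → Parent p c
  right : c ≡ 2 * p + 1 → Parent p c

toParent : ∀ {p c} → c ≡ 2 * p ⊎ c ≡ 2 * p + 1 → Parent p c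
toParent (inj₁ e) = left e
toParent (inj₂ e) = right e

fromParent : ∀ {p c} → Parent p c → c ≡ 2 * p ⊎ c ≡ 2 * p + 1
fromParent (left e) = inj₁ e
fromParent (right e) = inj₂ e

2*p+1≡1+2*p : ∀ p → 2 * p + 1 ≡ suc (2 * p)
2*p+1≡1+2*p p = +-comm (2 * p) 1

parentOf : ∀ c → Σ ℕ λ p → Parent p c
parentOf zero = 0 , left refl
parentOf (suc c) with parentOf c
... | p , left refl = p , right (sym (2*p+1≡1+2*p p))
... | p , right refl = suc p , left (trans (cong suc (2*p+1≡1+2*p p)) (sym (*-suc 2 p)))

Parent⇒2*p≤c : ∀ {p c} → Parent p c → 2 * p ≤ c
Parent⇒2*p≤c (left refl) = ≤-refl
Parent⇒2*p≤c (right refl) = m≤m+n _ 1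

Parent⇒c≤2*p+1 : ∀ {p c} → Parent p c → c ≤ 2 * p + 1
Parent⇒c≤2*p+1 (left refl) = m≤m+n _ 1
Parent⇒c≤2*p+1 (right refl) = ≤-refl

Parent⇒p<c : ∀ {p c} → 1 ≤ p → Parent p c → p < c
Parent⇒p<c {suc p} _ pc = <-≤-trans (m<m+n (suc p) {suc p + 0} (s≤s z≤n)) (Parent⇒2*p≤c {suc p} pc)

Parent⇒1≤c : ∀ {p c} → 1 ≤ p → Parent p c → 1 ≤ c
Parent⇒1≤c 1≤p pc = ≤-trans 1≤p (<⇒≤ (Parent⇒p<c 1≤p pc))

Parent⇒1≤p : ∀ {p c} → 2 ≤ c → Parent p c → 1 ≤ p
Parent⇒1≤p {zero} {suc (suc _)} _ (left ())
Parent⇒1≤p {zero} {suc (suc _)} _ (right ())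
Parent⇒1≤p {zero} {suc zero} (s≤s ()) _
Parent⇒1≤p {suc p} _ _ = s≤s z≤n

Parent-unique : ∀ {p q c} → Parent p c → Parent q c → p ≡ q
Parent-unique {p} {q} (left refl) (left e) = *-cancelˡ-≡ p q 2 e
Parent-unique {p} {q} (left refl) (right e) = ⊥-elim (even≢odd p q (trans e (2*p+1≡1+2*p q)))
Parent-unique {p} {q} (right refl) (left e) = ⊥-elim (even≢odd q p (trans (sym e) (2*p+1≡1+2*p p)))
Parent-unique {p} {q} (right refl) (right e) = *-cancelˡ-≡ p q 2 (+-cancelʳ-≡ 1 _ _ e)

children-distinct : ∀ p → 2 * p ≢ 2 * p + 1
children-distinct p e = even≢odd p p (trans e (2*p+1≡1+2*p p))

sibling : ∀ {p c} → Parent p c → Σ ℕ λ c′ → Parent p c′ × c′ ≢ c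
sibling {p} (left refl) = 2 * p + 1 , right refl , λ e → children-distinct p (sym e)
sibling {p} (right refl) = 2 * p , left refl , children-distinct p

Parent-< : ∀ {p c b} → p < b → Parent p c → c < 2 * b
Parent-< {p} {c} {b} p<b pc = ≤-<-trans (Parent⇒c≤2*p+1 {p} pc)
  (subst (_≤ 2 * b) (trans (*-suc 2 p) (sym (cong suc (2*p+1≡1+2*p p)))) (*-monoʳ-≤ 2 p<b))

Parent-≥ : ∀ {p c b} → b ≤ p → Parent p c → 2 * b ≤ c
Parent-≥ {p} b≤p pc = ≤-trans (*-monoʳ-≤ 2 b≤p) (Parent⇒2*p≤c {p} pc)

Parent-<⁻ : ∀ {p c b} → Parent p c → c < 2 * b → p < b
Parent-<⁻ {p} {b = b} pc c<2b with p <? b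
... | yes p<b = p<b
... | no p≮b = ⊥-elim (<⇒≱ c<2b (Parent-≥ (≮⇒≥ p≮b) pc))

Parent-≥⁻ : ∀ {p c b} → Parent p c → 2 * b ≤ c → b ≤ p
Parent-≥⁻ {p} {b = b} pc 2b≤c with p <? b
... | yes p<b = ⊥-elim (<⇒≱ (Parent-< p<b pc) 2b≤c)
... | no p≮b = ≮⇒≥ p≮b

TreeEdge-sym : ∀ {r f a b} → TreeEdge r f a b → TreeEdge r f b a
TreeEdge-sym (h , 1≤h , h<2^r , c , hc , inj₁ (e₁ , e₂)) = h , 1≤h , h<2^r , c , hc , inj₂ (e₂ , e₁)
TreeEdge-sym (h , 1≤h , h<2^r , c , hc , inj₂ (e₁ , e₂)) = h , 1≤h , h<2^r , c , hc , inj₁ (e₂ , e₁)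

treeEdge? : ∀ r f a b → Dec (TreeEdge r f a b)
treeEdge? r f a b = map′ edge unedge (anyUpTo? edgeAt? (2 ^ r))
  where
  Joins : ℕ → ℕ → Set
  Joins h c = (a ≡ f h × b ≡ f c) ⊎ (a ≡ f c × b ≡ f h)
  joins? : ∀ h c → Dec (Joins h c)
  joins? h c = ((a ≟ f h) ×-dec (b ≟ f c)) ⊎-dec ((a ≟ f c) ×-dec (b ≟ f h))
  EdgeAt : ℕ → Set
  EdgeAt h = 1 ≤ h × (Joins h (2 * h) ⊎ Joins h (2 * h + 1))
  edgeAt? : ∀ h → Dec (EdgeAt h)
  edgeAt? h = (1 ≤? h) ×-dec (joins? h (2 * h) ⊎-dec joins? h (2 * h + 1))
  edge : ∃ (λ h → h < 2 ^ r × EdgeAt h) → TreeEdge r f a b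
  edge (h , h<2^r , 1≤h , inj₁ j) = h , 1≤h , h<2^r , 2 * h , inj₁ refl , j
  edge (h , h<2^r , 1≤h , inj₂ j) = h , 1≤h , h<2^r , 2 * h + 1 , inj₂ refl , j
  unedge : TreeEdge r f a b → ∃ (λ h → h < 2 ^ r × EdgeAt h)
  unedge (h , 1≤h , h<2^r , _ , inj₁ refl , j) = h , h<2^r , 1≤h , inj₁ j
  unedge (h , 1≤h , h<2^r , _ , inj₂ refl , j) = h , h<2^r , 1≤h , inj₂ j

2^[1+k]≤3⇒2^[1+k]≤2 : ∀ k → 2 ^ suc k ≤ 3 → 2 ^ suc k ≤ 2
2^[1+k]≤3⇒2^[1+k]≤2 zero _ = ≤-refl
2^[1+k]≤3⇒2^[1+k]≤2 (suc k) 2^[2+k]≤3 = ⊥-elim (<⇒≱ (s≤s 2^[2+k]≤3) (*-monoʳ-≤ 2 (*-monoʳ-≤ 2 (m^n>0 2 k))))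

data Side : Set where
  A B : Side

other : Side → Side
other A = B
other B = A

other-≢ : ∀ s → other s ≢ s
other-≢ A ()
other-≢ B ()

side-cases : ∀ s t → t ≡ s ⊎ t ≡ other s
side-cases A A = inj₁ refl
side-cases A B = inj₂ refl
side-cases B A = inj₂ refl
side-cases B B = inj₁ refl

false≢true : false ≢ true
false≢true ()

-- lookup by a natural number, false beyond the end
lookupℕ : ∀ {m} → Vec Bool m → ℕ → Bool
lookupℕ [] _ = false
lookupℕ (b ∷ _) zero = b
lookupℕ (_ ∷ bs) (suc i) = lookupℕ bs i

lookupℕ-toℕ : ∀ {m} (bs : Vec Bool m) (i : Fin m) → lookupℕ bs (toℕ i) ≡ lookup bs i
lookupℕ-toℕ (_ ∷ _) Fin.zero = refl
lookupℕ-toℕ (_ ∷ bs) (Fin.suc i) = lookupℕ-toℕ bs i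

lookupℕ-tabulate : ∀ {m} (g : ℕ → Bool) {i} → i < m → lookupℕ (tabulate {n = m} (g ∘ toℕ)) i ≡ g i
lookupℕ-tabulate {suc m} g {zero} _ = refl
lookupℕ-tabulate {suc m} g {suc i} (s≤s i<m) = lookupℕ-tabulate (g ∘ suc) i<m

∈⇒lookupℕ≡true : ∀ {m} {p : Subset m} {x} → x ∈ p → lookupℕ p (toℕ x) ≡ true
∈⇒lookupℕ≡true {p = p} {x} x∈p = trans (lookupℕ-toℕ p x) ([]=⇒lookup x∈p)

lookupℕ≡true⇒∈ : ∀ {m} {p : Subset m} {x} → lookupℕ p (toℕ x) ≡ true → x ∈ p
lookupℕ≡true⇒∈ {p = p} {x} e = lookup⇒[]= x p (trans (sym (lookupℕ-toℕ p x)) e)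

interleave : ∀ {m} → Vec Bool m → ℕ → Bool
interleave [] _ = false
interleave (b ∷ _) zero = not b
interleave (b ∷ _) (suc zero) = b
interleave (_ ∷ bs) (suc (suc j)) = interleave bs j

interleave-even : ∀ {m} (bs : Vec Bool m) i → i < m → interleave bs (2 * i) ≡ not (lookupℕ bs i)
interleave-even (_ ∷ _) zero _ = refl
interleave-even (b ∷ bs) (suc i) (s≤s i<m) = trans (cong (interleave (b ∷ bs)) (*-suc 2 i)) (interleave-even bs i i<m)

interleave-odd : ∀ {m} (bs : Vec Bool m) i → interleave bs (2 * i + 1) ≡ lookupℕ bs i
interleave-odd [] _ = refl
interleave-odd (_ ∷ _) zero = refl
interleave-odd (b ∷ bs) (suc i) = trans (cong (λ j → interleave (b ∷ bs) (j + 1)) (*-suc 2 i)) (interleave-odd bs i)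

interleave-beyond : ∀ {m} (bs : Vec Bool m) j → 2 * m ≤ j → interleave bs j ≡ false
interleave-beyond [] _ _ = refl
interleave-beyond {suc m} (_ ∷ bs) j 2+2m≤j with subst (_≤ j) (*-suc 2 m) 2+2m≤j
... | s≤s (s≤s 2m≤j) = interleave-beyond bs _ 2m≤j

countBelow : (ℕ → Bool) → ℕ → ℕ
countBelow g zero = 0
countBelow g (suc a) = if g 0 then suc (countBelow (g ∘ suc) a) else countBelow (g ∘ suc) a

∣tabulate∣≡countBelow : ∀ m (g : ℕ → Bool) → ∣ tabulate {n = m} (g ∘ toℕ) ∣ ≡ countBelow g m
∣tabulate∣≡countBelow zero g = refl
∣tabulate∣≡countBelow (suc m) g with g 0
... | true = cong suc (∣tabulate∣≡countBelow m (g ∘ suc))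
... | false = ∣tabulate∣≡countBelow m (g ∘ suc)

countBelow-cong : ∀ {g g′} a → (∀ i → g i ≡ g′ i) → countBelow g a ≡ countBelow g′ a
countBelow-cong zero _ = refl
countBelow-cong {g} {g′} (suc a) g≗g′ rewrite g≗g′ 0 =
  cong (λ c → if g′ 0 then suc c else c) (countBelow-cong a (g≗g′ ∘ suc))

countBelow-+ : ∀ a b g → countBelow g (a + b) ≡ countBelow g a + countBelow (λ i → g (a + i)) b
countBelow-+ zero b g = refl
countBelow-+ (suc a) b g with g 0
... | true = cong suc (countBelow-+ a b (g ∘ suc))
... | false = countBelow-+ a b (g ∘ suc)

countBelow-false : ∀ a g → (∀ i → i < a → g i ≡ false) → countBelow g a ≡ 0
countBelow-false zero g _ = refl
countBelow-false (suc a) g g≡false rewrite g≡false 0 (s≤s z≤n) = countBelow-false a (g ∘ suc) (λ i i<a → g≡false (suc i) (s≤s i<a))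

countBelow-interleave : ∀ {m} (bs : Vec Bool m) a → countBelow (interleave bs) (2 * m + a) ≡ m
countBelow-interleave [] a = countBelow-false a (interleave []) (λ _ _ → refl)
countBelow-interleave {suc m} (b ∷ bs) a =
  trans (cong (λ c → countBelow (interleave (b ∷ bs)) (c + a)) (*-suc 2 m)) (pair b)
  where
  pair : ∀ b → countBelow (interleave (b ∷ bs)) (suc (suc (2 * m + a))) ≡ suc m
  pair true = cong suc (countBelow-interleave bs a)
  pair false = cong suc (countBelow-interleave bs a)

-- The glued binary tree GT(r) for r = k + 2

module GluedTree (k : ℕ) where

  r : ℕ
  r = suc (suc k)

  -- M = 2^(r-1) and N = 2^r; each copy has the internal vertices 1 ≤ h < N in heap order,
  -- among them the leaf parents M ≤ h < N, and the leaves N ≤ h < 2N are shared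
  M N 2N n : ℕ
  M = 2 ^ suc k
  N = 2 * M
  2N = 2 * N
  n = GTsize r

  -- number of internal vertices of one copy, and the first label of a leaf
  I : ℕ
  I = N ∸ 1

  M≥2 : 2 ≤ M
  M≥2 = *-monoʳ-≤ 2 (m^n>0 2 k)

  M≤N : M ≤ N
  M≤N = m≤m+n M (M + 0)

  N≥4 : 4 ≤ N
  N≥4 = *-monoʳ-≤ 2 M≥2

  N<2N : N < 2N
  N<2N = m<m+n N {N + 0} (≤-trans (s≤s z≤n) (m≤n⇒m≤n+o 0 N≥4))

  N≡1+I : N ≡ suc I
  N≡1+I = trans (sym (m∸n+n≡m (≤-trans (s≤s z≤n) N≥4))) (+-comm I 1)

  2^[r+1]≡2N : 2 ^ (r + 1) ≡ 2N
  2^[r+1]≡2N = trans (^-distribˡ-+-* 2 r 1) (*-comm N 2)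

  B₀ : ℕ
  B₀ = 2 ^ (r + 1) ∸ 1

  B₀≡I+N : B₀ ≡ I + N
  B₀≡I+N = begin
    2 ^ (r + 1) ∸ 1  ≡⟨ cong (_∸ 1) 2^[r+1]≡2N ⟩
    N + (N + 0) ∸ 1  ≡⟨ +-∸-comm (N + 0) (≤-trans (s≤s z≤n) N≥4) ⟩
    I + (N + 0)      ≡⟨ cong (I +_) (+-identityʳ N) ⟩
    I + N            ∎
    where open ≡-Reasoning

  n≡B₀+I : n ≡ B₀ + I
  n≡B₀+I = begin
    3 * N ∸ 2                ≡⟨ cong (λ x → 3 * x ∸ 2) N≡1+I ⟩
    3 * suc I ∸ 2            ≡⟨ cong (_∸ 2) (3*[1+i]≡i+[1+i]+i+2 I) ⟩
    I + suc I + I + 2 ∸ 2    ≡⟨ m+n∸n≡m (I + suc I + I) 2 ⟩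
    I + suc I + I            ≡⟨ cong (λ x → I + x + I) (sym N≡1+I) ⟩
    I + N + I                ≡⟨ cong (_+ I) (sym B₀≡I+N) ⟩
    B₀ + I                   ∎
    where
    open ≡-Reasoning
    open +-*-Solver
    3*[1+i]≡i+[1+i]+i+2 : ∀ i → 3 * suc i ≡ i + suc i + i + 2
    3*[1+i]≡i+[1+i]+i+2 = solve 1 (λ i → con 3 :* (con 1 :+ i) := i :+ (con 1 :+ i) :+ i :+ con 2) refl

  label : Side → ℕ → ℕ
  label A = aVert r
  label B = bVert r

  bVert-internal : ∀ {h} → h < N → bVert r h ≡ B₀ + (h ∸ 1)
  bVert-internal {h} h<N with h <ᵇ N | <⇒<ᵇ h<N
  ... | true | _ = refl

  bVert-leaf : ∀ {h} → N ≤ h → bVert r h ≡ h ∸ 1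
  bVert-leaf {h} N≤h with h <ᵇ N in eq
  ... | true = ⊥-elim (<⇒≱ (<ᵇ⇒< h N (subst T (sym eq) tt)) N≤h)
  ... | false = refl

  label-leaf : ∀ s {l} → N ≤ l → label s l ≡ l ∸ 1
  label-leaf A _ = refl
  label-leaf B = bVert-leaf

  leaf-label-sides : ∀ s t {l} → N ≤ l → label s l ≡ label t l
  leaf-label-sides s t N≤l = trans (label-leaf s N≤l) (sym (label-leaf t N≤l))

  child<N : ∀ {p c} → p < M → Parent p c → c < N
  child<N = Parent-< {b = M}

  child<2N : ∀ {p c} → p < N → Parent p c → c < 2N
  child<2N = Parent-< {b = N}

  parent<M : ∀ {p c} → Parent p c → c < N → p < M
  parent<M pc = Parent-<⁻ {b = M} pc

  parent<N : ∀ {p c} → Parent p c → c < 2N → p < N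
  parent<N pc = Parent-<⁻ {b = N} pc

  N≤⇒1≤ : ∀ {l} → N ≤ l → 1 ≤ l
  N≤⇒1≤ = ≤-trans (≤-trans (s≤s z≤n) N≥4)

  <N⇒<2N : ∀ {h} → h < N → h < 2N
  <N⇒<2N h<N = ≤-trans h<N (m≤m+n N (N + 0))

  aVert<B₀ : ∀ {h} → 1 ≤ h → h < 2N → aVert r h < B₀
  aVert<B₀ {h} 1≤h h<2N = subst (h ∸ 1 <_) (cong (_∸ 1) (sym 2^[r+1]≡2N)) (∸-monoˡ-< h<2N 1≤h)

  B₀≤bVert : ∀ {h} → h < N → B₀ ≤ bVert r h
  B₀≤bVert h<N = subst (B₀ ≤_) (sym (bVert-internal h<N)) (m≤m+n B₀ _)

  aVert≢bVert : ∀ {h h′} → 1 ≤ h → h < 2N → h′ < N → aVert r h ≢ bVert r h′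
  aVert≢bVert 1≤h h<2N h′<N e = <⇒≱ (aVert<B₀ 1≤h h<2N) (subst (B₀ ≤_) (sym e) (B₀≤bVert h′<N))

  label-injective : ∀ s {h h′} → 1 ≤ h → 1 ≤ h′ → h < 2N → h′ < 2N →
                    label s h ≡ label s h′ → h ≡ h′
  label-injective A 1≤h 1≤h′ _ _ e = ∸-cancelʳ-≡ 1≤h 1≤h′ e
  label-injective B {h} {h′} 1≤h 1≤h′ h<2N h′<2N e with h <? N | h′ <? N
  ... | yes h<N | yes h′<N = ∸-cancelʳ-≡ 1≤h 1≤h′
          (+-cancelˡ-≡ B₀ _ _ (trans (sym (bVert-internal h<N)) (trans e (bVert-internal h′<N))))
  ... | yes h<N | no h′≮N = ⊥-elim (aVert≢bVert 1≤h′ h′<2N h<N (trans (sym (bVert-leaf (≮⇒≥ h′≮N))) (sym e)))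
  ... | no h≮N | yes h′<N = ⊥-elim (aVert≢bVert 1≤h h<2N h′<N (trans (sym (bVert-leaf (≮⇒≥ h≮N))) e))
  ... | no h≮N | no h′≮N = ∸-cancelʳ-≡ 1≤h 1≤h′
          (trans (sym (bVert-leaf (≮⇒≥ h≮N))) (trans e (bVert-leaf (≮⇒≥ h′≮N))))

  aVert≡bVert⇒leaves : ∀ {h h′} → 1 ≤ h → 1 ≤ h′ → h < 2N → h′ < 2N →
                       aVert r h ≡ bVert r h′ → N ≤ h × N ≤ h′
  aVert≡bVert⇒leaves {h} {h′} 1≤h 1≤h′ h<2N h′<2N e with h′ <? N
  ... | yes h′<N = ⊥-elim (aVert≢bVert 1≤h h<2N h′<N e)
  ... | no h′≮N with ∸-cancelʳ-≡ 1≤h 1≤h′ (trans e (bVert-leaf (≮⇒≥ h′≮N)))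
  ...   | refl = ≮⇒≥ h′≮N , ≮⇒≥ h′≮N

  leaves-not-internal : ∀ {h h′} → N ≤ h × N ≤ h′ → ¬ (h < N ⊎ h′ < N)
  leaves-not-internal (N≤h , _) (inj₁ h<N) = <⇒≱ h<N N≤h
  leaves-not-internal (_ , N≤h′) (inj₂ h′<N) = <⇒≱ h′<N N≤h′

  internal-label-injective : ∀ s t {h h′} → 1 ≤ h → 1 ≤ h′ → h < 2N → h′ < 2N →
    label s h ≡ label t h′ → h < N ⊎ h′ < N → s ≡ t × h ≡ h′
  internal-label-injective A A 1≤h 1≤h′ h<2N h′<2N e _ = refl , label-injective A 1≤h 1≤h′ h<2N h′<2N e
  internal-label-injective B B 1≤h 1≤h′ h<2N h′<2N e _ = refl , label-injective B 1≤h 1≤h′ h<2N h′<2N e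
  internal-label-injective A B 1≤h 1≤h′ h<2N h′<2N e internal =
    ⊥-elim (leaves-not-internal (aVert≡bVert⇒leaves 1≤h 1≤h′ h<2N h′<2N e) internal)
  internal-label-injective B A 1≤h 1≤h′ h<2N h′<2N e internal =
    ⊥-elim (leaves-not-internal (swap (aVert≡bVert⇒leaves 1≤h′ 1≤h h′<2N h<2N (sym e))) internal)

  label-index-injective : ∀ s t {h h′} → 1 ≤ h → 1 ≤ h′ → h < 2N → h′ < 2N →
                          label s h ≡ label t h′ → h ≡ h′
  label-index-injective s t {h} {h′} 1≤h 1≤h′ h<2N h′<2N e with h <? N | h′ <? N
  ... | yes h<N | _ = proj₂ (internal-label-injective s t 1≤h 1≤h′ h<2N h′<2N e (inj₁ h<N))
  ... | no _ | yes h′<N = proj₂ (internal-label-injective s t 1≤h 1≤h′ h<2N h′<2N e (inj₂ h′<N))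
  ... | no h≮N | no h′≮N = ∸-cancelʳ-≡ 1≤h 1≤h′
          (trans (sym (label-leaf s (≮⇒≥ h≮N))) (trans e (label-leaf t (≮⇒≥ h′≮N))))

  label-side-injective : ∀ s t {h h′} → 1 ≤ h → 1 ≤ h′ → h < N → h′ < 2N →
                         label s h ≡ label t h′ → s ≡ t
  label-side-injective s t 1≤h 1≤h′ h<N h′<2N e =
    proj₁ (internal-label-injective s t 1≤h 1≤h′ (<N⇒<2N h<N) h′<2N e (inj₁ h<N))

  Adjℕ : ℕ → ℕ → Set
  Adjℕ x y = TreeEdge r (aVert r) x y ⊎ TreeEdge r (bVert r) x y

  record Edge (x y : ℕ) : Set where
    constructor edge
    field
      side : Side
      {p c} : ℕ
      1≤p : 1 ≤ p
      p<N : p < N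
      pc : Parent p c
      ends : (x ≡ label side p × y ≡ label side c) ⊎ (x ≡ label side c × y ≡ label side p)

  toEdge : ∀ {x y} → Adjℕ x y → Edge x y
  toEdge (inj₁ (_ , 1≤p , p<N , _ , pc , ends)) = edge A 1≤p p<N (toParent pc) ends
  toEdge (inj₂ (_ , 1≤p , p<N , _ , pc , ends)) = edge B 1≤p p<N (toParent pc) ends

  tree-edge : ∀ s {p c} → 1 ≤ p → p < N → Parent p c → Adjℕ (label s p) (label s c)
  tree-edge A 1≤p p<N pc = inj₁ (_ , 1≤p , p<N , _ , fromParent pc , inj₁ (refl , refl))
  tree-edge B 1≤p p<N pc = inj₂ (_ , 1≤p , p<N , _ , fromParent pc , inj₁ (refl , refl))

  Adjℕ-sym : ∀ {x y} → Adjℕ x y → Adjℕ y x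
  Adjℕ-sym = Sum.map (TreeEdge-sym {r}) (TreeEdge-sym {r})

  Adjℕ-irrefl : ∀ {x} → ¬ Adjℕ x x
  Adjℕ-irrefl adj with toEdge adj
  ... | edge s {p} {c} 1≤p p<N pc (inj₁ (e₁ , e₂)) = <⇒≢ (Parent⇒p<c 1≤p pc)
          (label-index-injective s s 1≤p (Parent⇒1≤c 1≤p pc) (<N⇒<2N p<N) (child<2N p<N pc) (trans (sym e₁) e₂))
  ... | edge s {p} {c} 1≤p p<N pc (inj₂ (e₁ , e₂)) = <⇒≢ (Parent⇒p<c 1≤p pc)
          (label-index-injective s s 1≤p (Parent⇒1≤c 1≤p pc) (<N⇒<2N p<N) (child<2N p<N pc) (trans (sym e₂) e₁))

  internal-neighbour : ∀ s {h m} → 1 ≤ h → h < N → Adjℕ (label s h) m →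
    (Σ ℕ λ q → Parent q h × 1 ≤ q × q < N × m ≡ label s q) ⊎ (Σ ℕ λ c → Parent h c × m ≡ label s c)
  internal-neighbour s 1≤h h<N adj with toEdge adj
  ... | edge t {p} {c} 1≤p p<N pc (inj₁ (e₁ , e₂))
    with internal-label-injective s t 1≤h 1≤p (<N⇒<2N h<N) (<N⇒<2N p<N) e₁ (inj₁ h<N)
  ...   | refl , refl = inj₂ (c , pc , e₂)
  internal-neighbour s 1≤h h<N adj | edge t {p} {c} 1≤p p<N pc (inj₂ (e₁ , e₂))
    with internal-label-injective s t 1≤h (Parent⇒1≤c 1≤p pc) (<N⇒<2N h<N) (child<2N p<N pc) e₁ (inj₁ h<N)
  ...   | refl , refl = inj₁ (p , pc , 1≤p , p<N , e₂)

  leaf-neighbour : ∀ s {l m} → N ≤ l → l < 2N → Adjℕ (label s l) m →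
    Σ ℕ λ q → Parent q l × 1 ≤ q × q < N × Σ Side λ t → m ≡ label t q
  leaf-neighbour s N≤l l<2N adj with toEdge adj
  ... | edge t {p} {c} 1≤p p<N pc (inj₁ (e₁ , _))
    with label-index-injective s t (N≤⇒1≤ N≤l) 1≤p l<2N (<N⇒<2N p<N) e₁
  ...   | refl = ⊥-elim (<⇒≱ p<N N≤l)
  leaf-neighbour s N≤l l<2N adj | edge t {p} {c} 1≤p p<N pc (inj₂ (e₁ , e₂))
    with label-index-injective s t (N≤⇒1≤ N≤l) (Parent⇒1≤c 1≤p pc) l<2N (child<2N p<N pc) e₁
  ...   | refl = p , pc , 1≤p , p<N , t , e₂

  upper-neighbour : ∀ s {p m} → 1 ≤ p → p < M → Adjℕ (label s p) m →
    Σ ℕ λ t → 1 ≤ t × t < N × m ≡ label s t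
  upper-neighbour s 1≤p p<M adj with internal-neighbour s 1≤p (<-≤-trans p<M M≤N) adj
  ... | inj₁ (q , _ , 1≤q , q<N , m≡) = q , 1≤q , q<N , m≡
  ... | inj₂ (c , pc , m≡) = c , Parent⇒1≤c 1≤p pc , child<N p<M pc , m≡

  adjacent-internals-same-side : ∀ s u {t q} → 1 ≤ t → t < N → 1 ≤ q → q < N →
    Adjℕ (label s t) (label u q) → u ≡ s
  adjacent-internals-same-side s u 1≤t t<N 1≤q q<N adj with internal-neighbour s 1≤t t<N adj
  ... | inj₁ (q′ , _ , 1≤q′ , q′<N , e) = label-side-injective u s 1≤q 1≤q′ q<N (<N⇒<2N q′<N) e
  ... | inj₂ (c , tc , e) = label-side-injective u s 1≤q (Parent⇒1≤c 1≤t tc) q<N (child<2N t<N tc) e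

  leafChild-neighbour : ∀ s {h c m} → M ≤ h → h < N → Parent h c → Adjℕ (label s c) m →
    Σ Side λ t → m ≡ label t h
  leafChild-neighbour s M≤h h<N hc adj with leaf-neighbour s (Parent-≥ M≤h hc) (child<2N h<N hc) adj
  ... | q , qc , _ , _ , t , m≡ with Parent-unique qc hc
  ...   | refl = t , m≡

  2N≡1+B₀ : 2N ≡ suc B₀
  2N≡1+B₀ = trans (sym 2^[r+1]≡2N) (trans (sym (m∸n+n≡m (m^n>0 2 (r + 1)))) (+-comm B₀ 1))

  label<n : ∀ s {h} → 1 ≤ h → h < 2N → label s h < n
  label<n A 1≤h h<2N = <-≤-trans (aVert<B₀ 1≤h h<2N) (subst (B₀ ≤_) (sym n≡B₀+I) (m≤m+n B₀ I))
  label<n B {h} 1≤h h<2N with h <? N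
  ... | yes h<N = subst₂ _<_ (sym (bVert-internal h<N)) (sym n≡B₀+I) (+-monoʳ-< B₀ (∸-monoˡ-< h<N 1≤h))
  ... | no h≮N = subst (_< n) (sym (bVert-leaf (≮⇒≥ h≮N))) (label<n A 1≤h h<2N)

  vertex : Side → (h : ℕ) → 1 ≤ h → h < 2N → Fin n
  vertex s h 1≤h h<2N = fromℕ< (label<n s 1≤h h<2N)

  toℕ-vertex : ∀ s h (1≤h : 1 ≤ h) (h<2N : h < 2N) → toℕ (vertex s h 1≤h h<2N) ≡ label s h
  toℕ-vertex s h 1≤h h<2N = toℕ-fromℕ< (label<n s 1≤h h<2N)

  Adj : Fin n → Fin n → Set
  Adj = GTAdj r

  labels⇒Adj : ∀ {x y : Fin n} {a b} → toℕ x ≡ a → toℕ y ≡ b → Adjℕ a b → Adj x y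
  labels⇒Adj refl refl e = e

  Adj⇒labels : ∀ {x y : Fin n} {a b} → toℕ x ≡ a → toℕ y ≡ b → Adj x y → Adjℕ a b
  Adj⇒labels refl refl e = e

  same-label⇒≡ : ∀ {x y : Fin n} {a} → toℕ x ≡ a → toℕ y ≡ a → x ≡ y
  same-label⇒≡ x≡a y≡a = toℕ-injective (trans x≡a (sym y≡a))

  data Position (x : Fin n) : Set where
    internal : ∀ s h → 1 ≤ h → h < N → toℕ x ≡ label s h → Position x
    leaf : ∀ l → N ≤ l → l < 2N → toℕ x ≡ label A l → Position x

  position : ∀ x → Position x
  position x with toℕ x <? I | toℕ x <? B₀
  ... | yes x<I | _ = internal A (suc (toℕ x)) (s≤s z≤n) (subst (suc (toℕ x) <_) (sym N≡1+I) (s≤s x<I)) refl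
  ... | no x≮I | yes x<B₀ =
    leaf (suc (toℕ x)) (subst (_≤ suc (toℕ x)) (sym N≡1+I) (s≤s (≮⇒≥ x≮I))) (subst (suc (toℕ x) <_) (sym 2N≡1+B₀) (s≤s x<B₀)) refl
  ... | _ | no x≮B₀ = internal B (suc (toℕ x ∸ B₀)) (s≤s z≤n) h<N (sym (trans (bVert-internal h<N) (m+[n∸m]≡n B₀≤x)))
    where
    B₀≤x : B₀ ≤ toℕ x
    B₀≤x = ≮⇒≥ x≮B₀
    h<N : suc (toℕ x ∸ B₀) < N
    h<N = subst (suc (toℕ x ∸ B₀) <_) (sym N≡1+I)
            (s≤s (subst (toℕ x ∸ B₀ <_) (m+n∸m≡n B₀ I) (∸-monoˡ-< (subst (toℕ x <_) n≡B₀+I (toℕ<n x)) B₀≤x)))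

  adj? : Decidable Adj
  adj? x y = treeEdge? r (aVert r) (toℕ x) (toℕ y) ⊎-dec treeEdge? r (bVert r) (toℕ x) (toℕ y)

  open WalkProperties Adj

  1<2N : 1 < 2N
  1<2N = <N⇒<2N (≤-trans (s≤s (s≤s z≤n)) N≥4)

  root : Side → Fin n
  root s = vertex s 1 (s≤s z≤n) 1<2N

  walkToRoot : ∀ s {h} → Acc _<_ h → 1 ≤ h → h < 2N → ∀ {x} → toℕ x ≡ label s h → Walk Adj x (root s)
  walkToRoot s {suc zero} _ _ _ x≡ = subst (λ y → Walk Adj y (root s)) (same-label⇒≡ (toℕ-vertex s 1 (s≤s z≤n) 1<2N) x≡) []
  walkToRoot s {suc (suc h)} (acc smaller) _ h<2N x≡ =
    labels⇒Adj x≡ (toℕ-vertex s p 1≤p p<2N) (Adjℕ-sym (tree-edge s 1≤p p<N ph))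
      ∷ walkToRoot s (smaller (Parent⇒p<c 1≤p ph)) 1≤p p<2N (toℕ-vertex s p 1≤p p<2N)
    where
    p = proj₁ (parentOf (suc (suc h)))
    ph = proj₂ (parentOf (suc (suc h)))
    1≤p = Parent⇒1≤p (s≤s (s≤s z≤n)) ph
    p<N = parent<N ph h<2N
    p<2N = <N⇒<2N p<N

  rootB→rootA : Walk Adj (root B) (root A)
  rootB→rootA = reverseʷ Adjℕ-sym (walkToRoot B (<-wellFounded N) 1≤N N<2N (trans (toℕ-vertex A N 1≤N N<2N) (leaf-label-sides A B ≤-refl)))
             ++ʷ walkToRoot A (<-wellFounded N) 1≤N N<2N (toℕ-vertex A N 1≤N N<2N)
    where
    1≤N = N≤⇒1≤ ≤-refl

  walkToRootA : ∀ x → Walk Adj x (root A)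
  walkToRootA x with position x
  ... | internal A h 1≤h h<N x≡ = walkToRoot A (<-wellFounded h) 1≤h (<N⇒<2N h<N) x≡
  ... | internal B h 1≤h h<N x≡ = walkToRoot B (<-wellFounded h) 1≤h (<N⇒<2N h<N) x≡ ++ʷ rootB→rootA
  ... | leaf l N≤l l<2N x≡ = walkToRoot A (<-wellFounded l) (N≤⇒1≤ N≤l) l<2N x≡

  connected : ∀ x y → Walk Adj x y
  connected x y = walkToRootA x ++ʷ reverseʷ Adjℕ-sym (walkToRootA y)

  -- Dual mutual-visibility sets

  vertical-uniqueMidpoint : ∀ s {p h c} {y x z : Fin n} → 1 ≤ p → Parent p h → h < N → Parent h c →
    toℕ y ≡ label s p → toℕ x ≡ label s h → toℕ z ≡ label s c → UniqueMidpoint y x z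
  vertical-uniqueMidpoint s {p} {h} {c} {y} {x} {z} 1≤p ph h<N hc y≡ x≡ z≡ = record
    { ends-distinct = λ { refl → <⇒≢ p<c (same 1≤p 1≤c p<2N c<2N (trans (sym y≡) z≡)) }
    ; ends-nonadjacent = nonadjacent
    ; first-edge = labels⇒Adj y≡ x≡ (tree-edge s 1≤p p<N ph)
    ; second-edge = labels⇒Adj x≡ z≡ (tree-edge s 1≤h h<N hc)
    ; unique = unique
    }
    where
    same : ∀ {a b} → 1 ≤ a → 1 ≤ b → a < 2N → b < 2N → label s a ≡ label s b → a ≡ b
    same = label-index-injective s s
    1≤h = Parent⇒1≤c 1≤p ph
    1≤c = Parent⇒1≤c 1≤h hc
    p<h = Parent⇒p<c 1≤p ph
    p<c = <-trans p<h (Parent⇒p<c 1≤h hc)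
    p<M = parent<M ph h<N
    p<N = <-trans p<h h<N
    p<2N = <N⇒<2N p<N
    c<2N = child<2N h<N hc
    nonadjacent : ¬ Adj y z
    nonadjacent yz with internal-neighbour s 1≤p p<N (Adj⇒labels y≡ z≡ yz)
    ... | inj₁ (q , qp , 1≤q , q<N , c≡q) =
      <⇒≢ (<-trans (Parent⇒p<c 1≤q qp) p<c) (sym (same 1≤c 1≤q c<2N (<N⇒<2N q<N) c≡q))
    ... | inj₂ (c′ , pc′ , c≡c′) with same 1≤c (Parent⇒1≤c 1≤p pc′) c<2N (child<2N p<N pc′) c≡c′
    ...   | refl = <⇒≢ p<h (Parent-unique pc′ hc)
    unique : ∀ w → Adj y w → Adj w z → w ≡ x
    unique w yw wz with internal-neighbour s 1≤p p<N (Adj⇒labels y≡ refl yw)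
    ... | inj₁ (q , qp , 1≤q , q<N , w≡) with internal-neighbour s 1≤q q<N (Adj⇒labels w≡ z≡ wz)
    ...   | inj₁ (q′ , q′q , 1≤q′ , q′<N , c≡q′) = ⊥-elim (<⇒≢
              (<-trans (<-trans (Parent⇒p<c 1≤q′ q′q) (Parent⇒p<c 1≤q qp)) p<c)
              (sym (same 1≤c 1≤q′ c<2N (<N⇒<2N q′<N) c≡q′)))
    ...   | inj₂ (c′ , qc′ , c≡c′) with same 1≤c (Parent⇒1≤c 1≤q qc′) c<2N (child<2N q<N qc′) c≡c′
    ...     | refl = ⊥-elim (<⇒≢ (<-trans (Parent⇒p<c 1≤q qp) p<h) (Parent-unique qc′ hc))
    unique w yw wz | inj₂ (c₂ , pc₂ , w≡)
      with internal-neighbour s (Parent⇒1≤c 1≤p pc₂) (child<N p<M pc₂) (Adj⇒labels w≡ z≡ wz)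
    ... | inj₁ (q , qc₂ , 1≤q , q<N , c≡q) with same 1≤c 1≤q c<2N (<N⇒<2N q<N) c≡q
    ...   | refl = ⊥-elim (<⇒≢ p<c (Parent-unique pc₂ qc₂))
    unique w yw wz | inj₂ (c₂ , pc₂ , w≡) | inj₂ (c₃ , c₂c₃ , c≡c₃)
      with same 1≤c (Parent⇒1≤c (Parent⇒1≤c 1≤p pc₂) c₂c₃) c<2N (child<2N (child<N p<M pc₂) c₂c₃) c≡c₃
    ...   | refl with Parent-unique c₂c₃ hc
    ...     | refl = same-label⇒≡ w≡ x≡

  sibling-uniqueMidpoint : ∀ s {h c₁ c₂} {y x z : Fin n} → 1 ≤ h → h < N → Parent h c₁ → Parent h c₂ →
    c₁ ≢ c₂ → c₁ < N → c₂ < N → toℕ y ≡ label s c₁ → toℕ x ≡ label s h → toℕ z ≡ label s c₂ →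
    UniqueMidpoint y x z
  sibling-uniqueMidpoint s {h} {c₁} {c₂} {y} {x} {z} 1≤h h<N hc₁ hc₂ c₁≢c₂ c₁<N c₂<N y≡ x≡ z≡ = record
    { ends-distinct = λ { refl → c₁≢c₂ (same 1≤c₁ 1≤c₂ (<N⇒<2N c₁<N) (<N⇒<2N c₂<N) (trans (sym y≡) z≡)) }
    ; ends-nonadjacent = nonadjacent
    ; first-edge = labels⇒Adj y≡ x≡ (Adjℕ-sym (tree-edge s 1≤h h<N hc₁))
    ; second-edge = labels⇒Adj x≡ z≡ (tree-edge s 1≤h h<N hc₂)
    ; unique = unique
    }
    where
    same : ∀ {a b} → 1 ≤ a → 1 ≤ b → a < 2N → b < 2N → label s a ≡ label s b → a ≡ b
    same = label-index-injective s s
    1≤c₁ = Parent⇒1≤c 1≤h hc₁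
    1≤c₂ = Parent⇒1≤c 1≤h hc₂
    nonadjacent : ¬ Adj y z
    nonadjacent yz with internal-neighbour s 1≤c₁ c₁<N (Adj⇒labels y≡ z≡ yz)
    ... | inj₁ (q , qc₁ , 1≤q , q<N , c₂≡q) with same 1≤c₂ 1≤q (<N⇒<2N c₂<N) (<N⇒<2N q<N) c₂≡q
    ...   | refl = <⇒≢ (Parent⇒p<c 1≤h hc₂) (sym (Parent-unique qc₁ hc₁))
    nonadjacent yz | inj₂ (c₃ , c₁c₃ , c₂≡c₃)
      with same 1≤c₂ (Parent⇒1≤c 1≤c₁ c₁c₃) (<N⇒<2N c₂<N) (child<2N c₁<N c₁c₃) c₂≡c₃
    ...   | refl = <⇒≢ (Parent⇒p<c 1≤h hc₁) (sym (Parent-unique c₁c₃ hc₂))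
    unique : ∀ w → Adj y w → Adj w z → w ≡ x
    unique w yw wz with internal-neighbour s 1≤c₁ c₁<N (Adj⇒labels y≡ refl yw)
    ... | inj₁ (q , qc₁ , _ , _ , w≡) with Parent-unique qc₁ hc₁
    ...   | refl = same-label⇒≡ w≡ x≡
    unique w yw wz | inj₂ (c₃ , c₁c₃ , w≡) with internal-neighbour s 1≤c₂ c₂<N (Adj⇒labels z≡ refl (Adjℕ-sym wz))
    ... | inj₁ (q , qc₂ , 1≤q , q<N , w≡′) with Parent-unique qc₂ hc₂
    ...   | refl = ⊥-elim (<⇒≢ (<-trans (Parent⇒p<c 1≤h hc₁) (Parent⇒p<c 1≤c₁ c₁c₃))
              (sym (same (Parent⇒1≤c 1≤c₁ c₁c₃) 1≤h (child<2N c₁<N c₁c₃) (<N⇒<2N h<N) (trans (sym w≡) w≡′))))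
    unique w yw wz | inj₂ (c₃ , c₁c₃ , w≡) | inj₂ (c₄ , c₂c₄ , w≡′)
      with same (Parent⇒1≤c 1≤c₁ c₁c₃) (Parent⇒1≤c 1≤c₂ c₂c₄) (child<2N c₁<N c₁c₃) (child<2N c₂<N c₂c₄) (trans (sym w≡) w≡′)
    ...   | refl = ⊥-elim (c₁≢c₂ (Parent-unique c₁c₃ c₂c₄))

  module DualSet {S : Subset n} (dual : IsDualMutualVisibility Adj S) where
    open Blocking Adjℕ-irrefl S

    private
      ends-differ : ∀ {y x z} → UniqueMidpoint y x z → x ∈ S → ExactlyOneOf S y z
      ends-differ = midpoint∈dual⇒exactlyOneEnd dual

    -- the ends of the three triples through x form a triangle, and
    -- "exactly one end in S" cannot hold around an odd cycle
    upper-internal∉S : ∀ s {h} {x : Fin n} → 2 ≤ h → h < M → toℕ x ≡ label s h → x ∉ S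
    upper-internal∉S s {h} {x} 2≤h h<M x≡ x∈S = odd-cycle (y ∈? S)
      where
      p = proj₁ (parentOf h)
      ph = proj₂ (parentOf h)
      1≤p = Parent⇒1≤p 2≤h ph
      1≤h = Parent⇒1≤c 1≤p ph
      h<N = <-≤-trans h<M M≤N
      p<2N = <N⇒<2N (<-trans (Parent⇒p<c 1≤p ph) h<N)
      hc₁ : Parent h (2 * h)
      hc₁ = left refl
      hc₂ : Parent h (2 * h + 1)
      hc₂ = right refl
      c₁<N = child<N h<M hc₁
      c₂<N = child<N h<M hc₂
      1≤c₁ = Parent⇒1≤c 1≤h hc₁
      1≤c₂ = Parent⇒1≤c 1≤h hc₂
      y = vertex s p 1≤p p<2N
      y≡ = toℕ-vertex s p 1≤p p<2N
      z₁ = vertex s (2 * h) 1≤c₁ (<N⇒<2N c₁<N)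
      z₁≡ = toℕ-vertex s (2 * h) 1≤c₁ (<N⇒<2N c₁<N)
      z₂ = vertex s (2 * h + 1) 1≤c₂ (<N⇒<2N c₂<N)
      z₂≡ = toℕ-vertex s (2 * h + 1) 1≤c₂ (<N⇒<2N c₂<N)
      y⊕z₁ : ExactlyOneOf S y z₁
      y⊕z₁ = ends-differ (vertical-uniqueMidpoint s 1≤p ph h<N hc₁ y≡ x≡ z₁≡) x∈S
      y⊕z₂ : ExactlyOneOf S y z₂
      y⊕z₂ = ends-differ (vertical-uniqueMidpoint s 1≤p ph h<N hc₂ y≡ x≡ z₂≡) x∈S
      z₁⊕z₂ : ExactlyOneOf S z₁ z₂
      z₁⊕z₂ = ends-differ (sibling-uniqueMidpoint s 1≤h h<N hc₁ hc₂ (children-distinct h) c₁<N c₂<N z₁≡ x≡ z₂≡) x∈S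
      odd-cycle : Dec (y ∈ S) → ⊥
      odd-cycle (yes y∈S) = proj₁ y⊕z₂ y∈S (proj₂ z₁⊕z₂ (proj₁ y⊕z₁ y∈S))
      odd-cycle (no y∉S) = proj₁ z₁⊕z₂ (proj₂ y⊕z₁ y∉S) (proj₂ y⊕z₂ y∉S)

    -- only for r = 2, where both children h, h′ of the root are leaf parents: every
    -- shortest path from h′ to a leaf child of h passes through the root
    root-path-¬visible : ∀ s {h h′} {x″ y x z : Fin n} → M ≤ h → h < N → Parent 1 h → Parent 1 h′ → h′ ≢ h →
      toℕ x″ ≡ label s h′ → toℕ y ≡ label s 1 → toℕ x ≡ label s h → toℕ z ≡ label s (2 * h) →
      y ∈ S → ¬ Visible Adj S x″ z
    root-path-¬visible s {h} {h′} {x″} {y} {x} {z} M≤h h<N 1h 1h′ h′≢h x″≡ y≡ x≡ z≡ y∈S =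
      blocked-distance₃⇒¬visible x″≢z nonadjacent no-common-neighbour blocked x″y yx xz
      where
      1≤h = Parent⇒1≤c (s≤s z≤n) 1h
      1≤h′ = Parent⇒1≤c (s≤s z≤n) 1h′
      M≤h′ : M ≤ h′
      M≤h′ = ≤-trans (2^[1+k]≤3⇒2^[1+k]≤2 k (≤-trans M≤h (Parent⇒c≤2*p+1 1h))) (Parent⇒2*p≤c 1h′)
      h′<N : h′ < N
      h′<N = ≤-trans (s≤s (Parent⇒c≤2*p+1 1h′)) N≥4
      1<N : 1 < N
      1<N = <-trans (Parent⇒p<c (s≤s z≤n) 1h) h<N
      hc : Parent h (2 * h)
      hc = left refl
      N≤c = Parent-≥ M≤h hc
      c<2N = child<2N h<N hc
      1≤c = Parent⇒1≤c 1≤h hc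
      x″≢z : x″ ≢ z
      x″≢z e = <⇒≱ h′<N (subst (N ≤_)
        (sym (label-index-injective s s 1≤h′ 1≤c (<N⇒<2N h′<N) c<2N (trans (sym x″≡) (trans (cong toℕ e) z≡)))) N≤c)
      nonadjacent : ¬ Adj x″ z
      nonadjacent a with internal-neighbour s 1≤h′ h′<N (Adj⇒labels x″≡ z≡ a)
      ... | inj₁ (q , _ , 1≤q , q<N , c≡q) =
        <⇒≱ q<N (subst (N ≤_) (label-index-injective s s 1≤c 1≤q c<2N (<N⇒<2N q<N) c≡q) N≤c)
      ... | inj₂ (c′ , h′c′ , c≡c′)
        with label-index-injective s s 1≤c (Parent⇒1≤c 1≤h′ h′c′) c<2N (child<2N h′<N h′c′) c≡c′
      ...   | refl = h′≢h (Parent-unique h′c′ hc)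
      z-neighbour : ∀ {w} → Adj w z → Σ Side λ t → toℕ w ≡ label t h
      z-neighbour wz = leafChild-neighbour s M≤h h<N hc (Adj⇒labels z≡ refl (Adjℕ-sym wz))
      no-common-neighbour : ∀ w → Adj x″ w → ¬ Adj w z
      no-common-neighbour w x″w wz with z-neighbour wz | internal-neighbour s 1≤h′ h′<N (Adj⇒labels x″≡ refl x″w)
      ... | t , w≡ | inj₁ (q , qh′ , 1≤q , q<N , w≡′)
        with label-index-injective t s 1≤h 1≤q (<N⇒<2N h<N) (<N⇒<2N q<N) (trans (sym w≡) w≡′)
      ...   | refl = <⇒≱ (≤-trans M≥2 M≤h) (≤-reflexive (Parent-unique qh′ 1h′))
      no-common-neighbour w x″w wz | t , w≡ | inj₂ (c′ , h′c′ , w≡′)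
        with label-index-injective t s 1≤h (Parent⇒1≤c 1≤h′ h′c′) (<N⇒<2N h<N) (child<2N h′<N h′c′) (trans (sym w≡) w≡′)
      ...   | refl = <⇒≱ h<N (Parent-≥ M≤h′ h′c′)
      blocked : ∀ w₁ w₂ → Adj x″ w₁ → Adj w₁ w₂ → Adj w₂ z → w₁ ∈ S ⊎ w₂ ∈ S
      blocked w₁ w₂ x″w₁ w₁w₂ w₂z with internal-neighbour s 1≤h′ h′<N (Adj⇒labels x″≡ refl x″w₁)
      ... | inj₁ (q , qh′ , _ , _ , w₁≡) with Parent-unique qh′ 1h′
      ...   | refl = inj₁ (subst (_∈ S) (same-label⇒≡ y≡ w₁≡) y∈S)
      blocked w₁ w₂ x″w₁ w₁w₂ w₂z | inj₂ (c′ , h′c′ , w₁≡)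
        with z-neighbour w₂z | leaf-neighbour s (Parent-≥ M≤h′ h′c′) (child<2N h′<N h′c′) (Adj⇒labels w₁≡ refl w₁w₂)
      ... | t , w₂≡ | q , qc′ , 1≤q , q<N , t′ , w₂≡′ with Parent-unique qc′ h′c′
      ...   | refl = ⊥-elim (h′≢h (sym (label-index-injective t t′ 1≤h 1≤h′ (<N⇒<2N h<N) (<N⇒<2N h′<N) (trans (sym w₂≡) w₂≡′))))
      x″y = labels⇒Adj x″≡ y≡ (Adjℕ-sym (tree-edge s (s≤s z≤n) 1<N 1h′))
      yx = labels⇒Adj y≡ x≡ (tree-edge s (s≤s z≤n) 1<N 1h)
      xz = labels⇒Adj x≡ z≡ (tree-edge s 1≤h h<N hc)

    root∈S⇒leafParent∉S : ∀ s {h} {x y : Fin n} → M ≤ h → h < N → Parent 1 h →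
      toℕ x ≡ label s h → toℕ y ≡ label s 1 → y ∈ S → x ∉ S
    root∈S⇒leafParent∉S s {h} {x} {y} M≤h h<N 1h x≡ y≡ y∈S x∈S =
      root-path-¬visible s M≤h h<N 1h 1h′ h′≢h x″≡ y≡ x≡ z≡ y∈S (proj₂ dual x″ z x″∉S z∉S)
      where
      h′ = proj₁ (sibling 1h)
      1h′ = proj₁ (proj₂ (sibling 1h))
      h′≢h = proj₂ (proj₂ (sibling 1h))
      1≤h = Parent⇒1≤c (s≤s z≤n) 1h
      1≤h′ = Parent⇒1≤c (s≤s z≤n) 1h′
      h′<N : h′ < N
      h′<N = ≤-trans (s≤s (Parent⇒c≤2*p+1 1h′)) N≥4
      hc : Parent h (2 * h)
      hc = left refl
      1≤c = Parent⇒1≤c 1≤h hc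
      x″ = vertex s h′ 1≤h′ (<N⇒<2N h′<N)
      x″≡ = toℕ-vertex s h′ 1≤h′ (<N⇒<2N h′<N)
      z = vertex s (2 * h) 1≤c (child<2N h<N hc)
      z≡ = toℕ-vertex s (2 * h) 1≤c (child<2N h<N hc)
      x″∉S : x″ ∉ S
      x″∉S = proj₁ (ends-differ (sibling-uniqueMidpoint s (s≤s z≤n) (<-trans (Parent⇒p<c (s≤s z≤n) 1h) h<N)
               1h 1h′ (h′≢h ∘ sym) h<N h′<N x≡ y≡ x″≡) y∈S) x∈S
      z∉S : z ∉ S
      z∉S = proj₁ (ends-differ (vertical-uniqueMidpoint s (s≤s z≤n) 1h h<N hc y≡ x≡ z≡) x∈S) y∈S

    leafChildren∈S⇒otherCopy∉S : ∀ s {h} {x x′ z₁ z₂ : Fin n} → M ≤ h → h < N →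
      toℕ x ≡ label s h → toℕ x′ ≡ label (other s) h →
      toℕ z₁ ≡ label s (2 * h) → toℕ z₂ ≡ label s (2 * h + 1) → z₁ ∈ S → z₂ ∈ S → x ∈ S → x′ ∉ S
    leafChildren∈S⇒otherCopy∉S s {h} {x} {x′} {z₁} {z₂} M≤h h<N x≡ x′≡ z₁≡ z₂≡ z₁∈S z₂∈S x∈S x′∈S =
      blocked-distance₂⇒¬visible z₁≢z₂ nonadjacent z₁x xz₂ common∈S (proj₁ dual z₁ z₂ z₁∈S z₂∈S)
      where
      hc₁ : Parent h (2 * h)
      hc₁ = left refl
      hc₂ : Parent h (2 * h + 1)
      hc₂ = right refl
      1≤h = ≤-trans (s≤s z≤n) (≤-trans M≥2 M≤h)
      N≤c₁ = Parent-≥ M≤h hc₁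
      N≤c₂ = Parent-≥ M≤h hc₂
      c₁<2N = child<2N h<N hc₁
      c₂<2N = child<2N h<N hc₂
      z₁≢z₂ : z₁ ≢ z₂
      z₁≢z₂ e = children-distinct h (label-index-injective s s (N≤⇒1≤ N≤c₁) (N≤⇒1≤ N≤c₂) c₁<2N c₂<2N
                  (trans (sym z₁≡) (trans (cong toℕ e) z₂≡)))
      nonadjacent : ¬ Adj z₁ z₂
      nonadjacent a with leaf-neighbour s N≤c₁ c₁<2N (Adj⇒labels z₁≡ z₂≡ a)
      ... | q , _ , 1≤q , q<N , t , c₂≡q =
        <⇒≱ q<N (subst (N ≤_) (label-index-injective s t (N≤⇒1≤ N≤c₂) 1≤q c₂<2N (<N⇒<2N q<N) c₂≡q) N≤c₂)
      common∈S : ∀ w → Adj z₁ w → Adj w z₂ → w ∈ S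
      common∈S w z₁w _ with leafChild-neighbour s M≤h h<N hc₁ (Adj⇒labels z₁≡ refl z₁w)
      ... | t , w≡ with side-cases s t
      ...   | inj₁ refl = subst (_∈ S) (same-label⇒≡ x≡ w≡) x∈S
      ...   | inj₂ refl = subst (_∈ S) (same-label⇒≡ x′≡ w≡) x′∈S
      z₁x = labels⇒Adj z₁≡ x≡ (Adjℕ-sym (tree-edge s 1≤h h<N hc₁))
      xz₂ = labels⇒Adj x≡ z₂≡ (tree-edge s 1≤h h<N hc₂)

    parent-otherCopy-¬visible : ∀ s {p h} {y x x′ z₁ z₂ : Fin n} → 1 ≤ p → Parent p h → M ≤ h → h < N →
      toℕ y ≡ label s p → toℕ x ≡ label s h → toℕ x′ ≡ label (other s) h →
      toℕ z₁ ≡ label s (2 * h) → toℕ z₂ ≡ label s (2 * h + 1) → z₁ ∈ S → z₂ ∈ S → ¬ Visible Adj S y x′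
    parent-otherCopy-¬visible s {p} {h} {y} {x} {x′} {z₁} {z₂} 1≤p ph M≤h h<N y≡ x≡ x′≡ z₁≡ z₂≡ z₁∈S z₂∈S =
      blocked-distance₃⇒¬visible y≢x′ nonadjacent no-common-neighbour blocked yx xz₁ z₁x′
      where
      1≤h = Parent⇒1≤c 1≤p ph
      p<M = parent<M ph h<N
      p<N = <-≤-trans p<M M≤N
      hc₁ : Parent h (2 * h)
      hc₁ = left refl
      N≤c₁ = Parent-≥ M≤h hc₁
      N≤c₂ = Parent-≥ M≤h (right refl)
      ¬adj-other : ∀ {t q} → 1 ≤ t → t < N → 1 ≤ q → q < N → ¬ Adjℕ (label s t) (label (other s) q)
      ¬adj-other 1≤t t<N 1≤q q<N a = other-≢ s (adjacent-internals-same-side s (other s) 1≤t t<N 1≤q q<N a)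
      y≢x′ : y ≢ x′
      y≢x′ e = other-≢ s (sym (label-side-injective s (other s) 1≤p 1≤h p<N (<N⇒<2N h<N)
                 (trans (sym y≡) (trans (cong toℕ e) x′≡))))
      nonadjacent : ¬ Adj y x′
      nonadjacent a = ¬adj-other 1≤p p<N 1≤h h<N (Adj⇒labels y≡ x′≡ a)
      no-common-neighbour : ∀ w → Adj y w → ¬ Adj w x′
      no-common-neighbour w yw wx′ with upper-neighbour s 1≤p p<M (Adj⇒labels y≡ refl yw)
      ... | t , 1≤t , t<N , w≡ = ¬adj-other 1≤t t<N 1≤h h<N (Adj⇒labels w≡ x′≡ wx′)
      blocked : ∀ w₁ w₂ → Adj y w₁ → Adj w₁ w₂ → Adj w₂ x′ → w₁ ∈ S ⊎ w₂ ∈ S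
      blocked w₁ w₂ yw₁ w₁w₂ w₂x′ with internal-neighbour (other s) 1≤h h<N (Adj⇒labels x′≡ refl (Adjℕ-sym w₂x′))
      ... | inj₂ (_ , left refl , w₂≡) =
        inj₂ (subst (_∈ S) (same-label⇒≡ z₁≡ (trans w₂≡ (leaf-label-sides (other s) s N≤c₁))) z₁∈S)
      ... | inj₂ (_ , right refl , w₂≡) =
        inj₂ (subst (_∈ S) (same-label⇒≡ z₂≡ (trans w₂≡ (leaf-label-sides (other s) s N≤c₂))) z₂∈S)
      ... | inj₁ (q , _ , 1≤q , q<N , w₂≡) with upper-neighbour s 1≤p p<M (Adj⇒labels y≡ refl yw₁)
      ...   | t , 1≤t , t<N , w₁≡ = ⊥-elim (¬adj-other 1≤t t<N 1≤q q<N (Adj⇒labels w₁≡ w₂≡ w₁w₂))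
      yx = labels⇒Adj y≡ x≡ (tree-edge s 1≤p p<N ph)
      xz₁ = labels⇒Adj x≡ z₁≡ (tree-edge s 1≤h h<N hc₁)
      z₁x′ = labels⇒Adj (trans z₁≡ (leaf-label-sides s (other s) N≤c₁)) x′≡ (Adjℕ-sym (tree-edge (other s) 1≤h h<N hc₁))

    leafParent∉S : ∀ s {h} {x : Fin n} → M ≤ h → h < N → toℕ x ≡ label s h → x ∉ S
    leafParent∉S s {h} {x} M≤h h<N x≡ x∈S = by-parent (y ∈? S)
      where
      2≤h = ≤-trans M≥2 M≤h
      p = proj₁ (parentOf h)
      ph = proj₂ (parentOf h)
      1≤p = Parent⇒1≤p 2≤h ph
      1≤h = Parent⇒1≤c 1≤p ph
      p<M = parent<M ph h<N
      p<2N = <N⇒<2N (<-≤-trans p<M M≤N)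
      hc₁ : Parent h (2 * h)
      hc₁ = left refl
      hc₂ : Parent h (2 * h + 1)
      hc₂ = right refl
      y = vertex s p 1≤p p<2N
      y≡ = toℕ-vertex s p 1≤p p<2N
      z₁≡ = toℕ-vertex s (2 * h) (Parent⇒1≤c 1≤h hc₁) (child<2N h<N hc₁)
      z₂≡ = toℕ-vertex s (2 * h + 1) (Parent⇒1≤c 1≤h hc₂) (child<2N h<N hc₂)
      x′ = vertex (other s) h 1≤h (<N⇒<2N h<N)
      x′≡ = toℕ-vertex (other s) h 1≤h (<N⇒<2N h<N)
      by-parent : Dec (y ∈ S) → ⊥
      by-parent (yes y∈S) with 2 ≤? p
      ... | yes 2≤p = upper-internal∉S s 2≤p p<M y≡ y∈S
      ... | no 2≰p = root∈S⇒leafParent∉S s M≤h h<N (subst (λ q → Parent q h) p≡1 ph) x≡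
                       (trans y≡ (cong (label s) p≡1)) y∈S x∈S
        where
        p≡1 : p ≡ 1
        p≡1 = ≤-antisym (≤-pred (≰⇒> 2≰p)) 1≤p
      by-parent (no y∉S) =
        parent-otherCopy-¬visible s 1≤p ph M≤h h<N y≡ x≡ x′≡ z₁≡ z₂≡ z₁∈S z₂∈S (proj₂ dual y x′ y∉S x′∉S)
        where
        z₁∈S = proj₂ (ends-differ (vertical-uniqueMidpoint s 1≤p ph h<N hc₁ y≡ x≡ z₁≡) x∈S) y∉S
        z₂∈S = proj₂ (ends-differ (vertical-uniqueMidpoint s 1≤p ph h<N hc₂ y≡ x≡ z₂≡) x∈S) y∉S
        x′∉S = leafChildren∈S⇒otherCopy∉S s M≤h h<N x≡ x′≡ z₁≡ z₂≡ z₁∈S z₂∈S x∈S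

    internal≥2∉S : ∀ s {h} {x : Fin n} → 2 ≤ h → h < N → toℕ x ≡ label s h → x ∉ S
    internal≥2∉S s {h} 2≤h h<N x≡ with h <? M
    ... | yes h<M = upper-internal∉S s 2≤h h<M x≡
    ... | no h≮M = leafParent∉S s (≮⇒≥ h≮M) h<N x≡

    root∉S : ∀ s {x : Fin n} → toℕ x ≡ label s 1 → x ∉ S
    root∉S s {x} x≡ x∈S = one-child∈S (v₂ ∈? S)
      where
      2<N : 2 < N
      2<N = ≤-trans (s≤s (s≤s (s≤s z≤n))) N≥4
      3<N : 3 < N
      3<N = N≥4
      v₂ = vertex s 2 (s≤s z≤n) (<N⇒<2N 2<N)
      v₂≡ = toℕ-vertex s 2 (s≤s z≤n) (<N⇒<2N 2<N)
      v₃ = vertex s 3 (s≤s z≤n) (<N⇒<2N 3<N)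
      v₃≡ = toℕ-vertex s 3 (s≤s z≤n) (<N⇒<2N 3<N)
      v₂⊕v₃ : ExactlyOneOf S v₂ v₃
      v₂⊕v₃ = ends-differ (sibling-uniqueMidpoint s (s≤s z≤n) (<-trans (s≤s (s≤s z≤n)) 2<N) (left refl) (right refl)
                (λ ()) 2<N 3<N v₂≡ x≡ v₃≡) x∈S
      one-child∈S : Dec (v₂ ∈ S) → ⊥
      one-child∈S (yes v₂∈S) = internal≥2∉S s ≤-refl 2<N v₂≡ v₂∈S
      one-child∈S (no v₂∉S) = internal≥2∉S s (s≤s (s≤s z≤n)) 3<N v₃≡ (proj₂ v₂⊕v₃ v₂∉S)

    internal∉S : ∀ s {h} {x : Fin n} → 1 ≤ h → h < N → toℕ x ≡ label s h → x ∉ S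
    internal∉S s {suc zero} _ _ x≡ = root∉S s x≡
    internal∉S s {suc (suc h)} _ h<N x≡ = internal≥2∉S s (s≤s (s≤s z≤n)) h<N x≡

    -- the two copies of the parent are outside S and have the two leaves as their only common neighbours
    leaf-siblings-not-both∈S : ∀ {q} {z₁ z₂ : Fin n} → M ≤ q → q < N →
      toℕ z₁ ≡ label A (2 * q) → toℕ z₂ ≡ label A (2 * q + 1) → z₁ ∈ S → z₂ ∈ S → ⊥
    leaf-siblings-not-both∈S {q} {z₁} {z₂} M≤q q<N z₁≡ z₂≡ z₁∈S z₂∈S =
      blocked-distance₂⇒¬visible y≢y′ nonadjacent yz₁ z₁y′ common∈S
        (proj₂ dual y y′ (internal∉S A 1≤q q<N y≡) (internal∉S B 1≤q q<N y′≡))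
      where
      1≤q = ≤-trans (s≤s z≤n) (≤-trans M≥2 M≤q)
      qc₁ : Parent q (2 * q)
      qc₁ = left refl
      y = vertex A q 1≤q (<N⇒<2N q<N)
      y≡ = toℕ-vertex A q 1≤q (<N⇒<2N q<N)
      y′ = vertex B q 1≤q (<N⇒<2N q<N)
      y′≡ = toℕ-vertex B q 1≤q (<N⇒<2N q<N)
      y≢y′ : y ≢ y′
      y≢y′ e with label-side-injective A B 1≤q 1≤q q<N (<N⇒<2N q<N) (trans (sym y≡) (trans (cong toℕ e) y′≡))
      ... | ()
      nonadjacent : ¬ Adj y y′
      nonadjacent a with adjacent-internals-same-side A B 1≤q q<N 1≤q q<N (Adj⇒labels y≡ y′≡ a)
      ... | ()
      common∈S : ∀ w → Adj y w → Adj w y′ → w ∈ S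
      common∈S w yw wy′ with internal-neighbour A 1≤q q<N (Adj⇒labels y≡ refl yw)
      ... | inj₂ (_ , left refl , w≡) = subst (_∈ S) (same-label⇒≡ z₁≡ w≡) z₁∈S
      ... | inj₂ (_ , right refl , w≡) = subst (_∈ S) (same-label⇒≡ z₂≡ w≡) z₂∈S
      ... | inj₁ (t , _ , 1≤t , t<N , w≡) with adjacent-internals-same-side A B 1≤t t<N 1≤q q<N (Adj⇒labels w≡ y′≡ wy′)
      ...   | ()
      yz₁ = labels⇒Adj y≡ z₁≡ (tree-edge A 1≤q q<N qc₁)
      z₁y′ = labels⇒Adj (trans z₁≡ (leaf-label-sides A B (Parent-≥ M≤q qc₁))) y′≡ (Adjℕ-sym (tree-edge B 1≤q q<N qc₁))

  -- Leaf transversals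

  -- the leaf labels are I + j for j < N, and leaf pair i has labels I + 2i, I + 2i + 1;
  -- f chooses the right leaf of pair i if i ∈ f, and the left one otherwise
  chosenLabel : Subset M → ℕ → Bool
  chosenLabel f m = if m <ᵇ I then false else interleave f (m ∸ I)

  transversal : Subset M → Subset n
  transversal f = tabulate (λ x → chosenLabel f (toℕ x))

  lookupℕ-transversal : ∀ f (x : Fin n) → lookupℕ (transversal f) (toℕ x) ≡ chosenLabel f (toℕ x)
  lookupℕ-transversal f x = lookupℕ-tabulate (chosenLabel f) (toℕ<n x)

  chosenLabel-internal : ∀ f {m} → m < I → chosenLabel f m ≡ false
  chosenLabel-internal f {m} m<I with m <ᵇ I | <⇒<ᵇ m<I
  ... | true | _ = refl

  chosenLabel-shift : ∀ f j → chosenLabel f (I + j) ≡ interleave f j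
  chosenLabel-shift f j with (I + j) <ᵇ I in eq
  ... | true = ⊥-elim (<⇒≱ (<ᵇ⇒< (I + j) I (subst T (sym eq) tt)) (m≤m+n I j))
  ... | false = cong (interleave f) (m+n∸m≡n I j)

  chosenLabel-leaf : ∀ f {l} → N ≤ l → chosenLabel f (l ∸ 1) ≡ interleave f (l ∸ N)
  chosenLabel-leaf f {l} N≤l = begin
    chosenLabel f (l ∸ 1)              ≡⟨ cong (chosenLabel f) (sym (m+[n∸m]≡n (∸-monoˡ-≤ 1 N≤l))) ⟩
    chosenLabel f (I + (l ∸ 1 ∸ I))    ≡⟨ chosenLabel-shift f _ ⟩
    interleave f (l ∸ 1 ∸ I)           ≡⟨ cong (interleave f) (trans (∸-+-assoc l 1 I) (cong (l ∸_) (sym N≡1+I))) ⟩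
    interleave f (l ∸ N)               ∎
    where open ≡-Reasoning

  chosenLabel-B : ∀ f {h} → h < N → chosenLabel f (label B h) ≡ false
  chosenLabel-B f {h} h<N = begin
    chosenLabel f (bVert r h)            ≡⟨ cong (chosenLabel f) (trans (bVert-internal h<N) (trans (cong (_+ (h ∸ 1)) B₀≡I+N) (+-assoc I N (h ∸ 1)))) ⟩
    chosenLabel f (I + (N + (h ∸ 1)))    ≡⟨ chosenLabel-shift f _ ⟩
    interleave f (N + (h ∸ 1))           ≡⟨ interleave-beyond f _ (m≤m+n N _) ⟩
    false                                ∎
    where open ≡-Reasoning

  ∣transversal∣≡M : ∀ f → ∣ transversal f ∣ ≡ M
  ∣transversal∣≡M f = begin
    ∣ transversal f ∣                                                      ≡⟨ ∣tabulate∣≡countBelow n (chosenLabel f) ⟩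
    countBelow (chosenLabel f) n                                           ≡⟨ cong (countBelow (chosenLabel f)) n≡I+[N+I] ⟩
    countBelow (chosenLabel f) (I + (N + I))                               ≡⟨ countBelow-+ I (N + I) (chosenLabel f) ⟩
    countBelow (chosenLabel f) I + countBelow (chosenLabel f ∘ (I +_)) (N + I)
      ≡⟨ cong₂ _+_ (countBelow-false I (chosenLabel f) (λ _ → chosenLabel-internal f))
                   (countBelow-cong (N + I) (chosenLabel-shift f)) ⟩
    countBelow (interleave f) (N + I)                                      ≡⟨ countBelow-interleave f I ⟩
    M                                                                      ∎
    where
    open ≡-Reasoning
    n≡I+[N+I] : n ≡ I + (N + I)
    n≡I+[N+I] = trans n≡B₀+I (trans (cong (_+ I) B₀≡I+N) (+-assoc I N I))

  N+<2N : ∀ {j} → j < N → N + j < 2N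
  N+<2N {j} j<N = subst (N + j <_) (cong (N +_) (sym (+-identityʳ N))) (+-monoʳ-< N j<N)

  rightLeaf-label : ∀ i → N + (2 * i + 1) ∸ 1 ≡ N + 2 * i
  rightLeaf-label i = trans (+-∸-assoc N (m≤n+m 1 (2 * i))) (cong (N +_) (m+n∸n≡m (2 * i) 1))

  lookupℕ-transversal-rightLeaf : ∀ f {i} → i < M → lookupℕ (transversal f) (N + 2 * i) ≡ lookupℕ f i
  lookupℕ-transversal-rightLeaf f {i} i<M = begin
    lookupℕ (transversal f) (N + 2 * i)   ≡⟨ lookupℕ-tabulate (chosenLabel f) label<n′ ⟩
    chosenLabel f (N + 2 * i)             ≡⟨ cong (chosenLabel f) (sym (rightLeaf-label i)) ⟩
    chosenLabel f (l ∸ 1)                 ≡⟨ chosenLabel-leaf f (m≤m+n N _) ⟩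
    interleave f (l ∸ N)                  ≡⟨ cong (interleave f) (m+n∸m≡n N (2 * i + 1)) ⟩
    interleave f (2 * i + 1)              ≡⟨ interleave-odd f i ⟩
    lookupℕ f i                           ∎
    where
    open ≡-Reasoning
    l = N + (2 * i + 1)
    label<n′ : N + 2 * i < n
    label<n′ = subst (_< n) (rightLeaf-label i)
      (label<n A (N≤⇒1≤ (m≤m+n N _)) (N+<2N (child<N i<M (right {i} refl))))

  choiceOf : Subset n → Subset M
  choiceOf S = tabulate (λ i → lookupℕ S (N + 2 * toℕ i))

  choiceOf-transversal : ∀ f → choiceOf (transversal f) ≡ f
  choiceOf-transversal f = trans
    (tabulate-cong (λ i → trans (lookupℕ-transversal-rightLeaf f (toℕ<n i)) (lookupℕ-toℕ f i)))
    (tabulate∘lookup f)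

  transversal-injective : Injective _≡_ _≡_ transversal
  transversal-injective {f} {f′} e =
    trans (sym (choiceOf-transversal f)) (trans (cong choiceOf e) (choiceOf-transversal f′))

  ∈transversal⇒chosen : ∀ f {x : Fin n} → x ∈ transversal f → chosenLabel f (toℕ x) ≡ true
  ∈transversal⇒chosen f {x} x∈T = trans (sym (lookupℕ-transversal f x)) (∈⇒lookupℕ≡true x∈T)

  ∈transversal⇒leaf : ∀ f {x : Fin n} → x ∈ transversal f →
    Σ ℕ λ l → N ≤ l × l < 2N × toℕ x ≡ label A l × interleave f (l ∸ N) ≡ true
  ∈transversal⇒leaf f {x} x∈T with position x
  ... | internal A h 1≤h h<N x≡ = ⊥-elim (false≢true (begin
    false                   ≡⟨ sym (chosenLabel-internal f (∸-monoˡ-< h<N 1≤h)) ⟩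
    chosenLabel f (h ∸ 1)   ≡⟨ cong (chosenLabel f) (sym x≡) ⟩
    chosenLabel f (toℕ x)   ≡⟨ ∈transversal⇒chosen f x∈T ⟩
    true                    ∎))
    where open ≡-Reasoning
  ... | internal B h _ h<N x≡ = ⊥-elim (false≢true (begin
    false                       ≡⟨ sym (chosenLabel-B f h<N) ⟩
    chosenLabel f (label B h)   ≡⟨ cong (chosenLabel f) (sym x≡) ⟩
    chosenLabel f (toℕ x)       ≡⟨ ∈transversal⇒chosen f x∈T ⟩
    true                        ∎))
    where open ≡-Reasoning
  ... | leaf l N≤l l<2N x≡ = l , N≤l , l<2N , x≡ ,
    trans (sym (chosenLabel-leaf f N≤l)) (trans (cong (chosenLabel f) (sym x≡)) (∈transversal⇒chosen f x∈T))

  pairIndex<M : ∀ {q} → M ≤ q → q < N → q ∸ M < M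
  pairIndex<M {q} M≤q q<N = subst (q ∸ M <_) (trans (m+n∸m≡n M (M + 0)) (+-identityʳ M)) (∸-monoˡ-< q<N M≤q)

  interleave-pair : ∀ f {q} → M ≤ q → q < N →
    interleave f (2 * q ∸ N) ≡ not (lookupℕ f (q ∸ M)) × interleave f (2 * q + 1 ∸ N) ≡ lookupℕ f (q ∸ M)
  interleave-pair f {q} M≤q q<N =
    trans (cong (interleave f) 2q∸N) (interleave-even f (q ∸ M) (pairIndex<M M≤q q<N)) ,
    trans (cong (interleave f) 2q+1∸N) (interleave-odd f (q ∸ M))
    where
    2q∸N : 2 * q ∸ N ≡ 2 * (q ∸ M)
    2q∸N = sym (*-distribˡ-∸ 2 q M)
    2q+1∸N : 2 * q + 1 ∸ N ≡ 2 * (q ∸ M) + 1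
    2q+1∸N = trans (+-∸-comm 1 (*-monoʳ-≤ 2 M≤q)) (cong (_+ 1) 2q∸N)

  sibling-unchosen : ∀ f {q l} → Parent q l → M ≤ q → q < N →
    Σ ℕ λ l′ → Parent q l′ × interleave f (l′ ∸ N) ≡ not (interleave f (l ∸ N))
  sibling-unchosen f {q} (left refl) M≤q q<N = 2 * q + 1 , right refl ,
    trans (proj₂ pair) (trans (sym (not-involutive _)) (cong not (sym (proj₁ pair))))
    where pair = interleave-pair f M≤q q<N
  sibling-unchosen f {q} (right refl) M≤q q<N = 2 * q , left refl ,
    trans (proj₁ pair) (cong not (sym (proj₂ pair)))
    where pair = interleave-pair f M≤q q<N

  -- a chosen leaf is bypassed through its unchosen sibling, which has the same neighbours
  transversal-bypassable : ∀ f → Bypassable (transversal f)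
  transversal-bypassable f {u} {w} {x} uw wx _ w∈T with ∈transversal⇒leaf f w∈T
  ... | l , N≤l , l<2N , w≡ , chosen
    with leaf-neighbour A N≤l l<2N (Adj⇒labels w≡ refl (Adjℕ-sym uw)) | leaf-neighbour A N≤l l<2N (Adj⇒labels w≡ refl wx)
  ... | q , ql , 1≤q , q<N , t , u≡ | _ , q′l , _ , _ , t′ , x≡ with Parent-unique q′l ql
  ... | refl = w′ , labels⇒Adj u≡ (trans w′≡ (leaf-label-sides A t N≤l′)) (tree-edge t 1≤q q<N ql′)
                 , labels⇒Adj (trans w′≡ (leaf-label-sides A t′ N≤l′)) x≡ (Adjℕ-sym (tree-edge t′ 1≤q q<N ql′))
                 , w′∉T
    where
    M≤q = Parent-≥⁻ {b = M} ql N≤l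
    sib = sibling-unchosen f ql M≤q q<N
    l′ = proj₁ sib
    ql′ = proj₁ (proj₂ sib)
    N≤l′ = Parent-≥ M≤q ql′
    w′ = vertex A l′ (N≤⇒1≤ N≤l′) (child<2N q<N ql′)
    w′≡ = toℕ-vertex A l′ (N≤⇒1≤ N≤l′) (child<2N q<N ql′)
    w′∉T : w′ ∉ transversal f
    w′∉T w′∈T = false≢true (begin
      false                        ≡⟨ sym (cong not chosen) ⟩
      not (interleave f (l ∸ N))   ≡⟨ sym (proj₂ (proj₂ sib)) ⟩
      interleave f (l′ ∸ N)        ≡⟨ sym (chosenLabel-leaf f N≤l′) ⟩
      chosenLabel f (l′ ∸ 1)       ≡⟨ cong (chosenLabel f) (sym w′≡) ⟩
      chosenLabel f (toℕ w′)       ≡⟨ ∈transversal⇒chosen f w′∈T ⟩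
      true                         ∎)
      where open ≡-Reasoning

  transversal-total : ∀ f → IsTotalMutualVisibility Adj (transversal f)
  transversal-total f = bypassable⇒totalMutualVisibility adj? connected (transversal-bypassable f)

  lookupℕ-choiceOf : ∀ S {q} → M ≤ q → q < N → lookupℕ (choiceOf S) (q ∸ M) ≡ lookupℕ S (2 * q)
  lookupℕ-choiceOf S {q} M≤q q<N =
    trans (lookupℕ-tabulate (λ i → lookupℕ S (N + 2 * i)) (pairIndex<M M≤q q<N))
          (cong (lookupℕ S) (trans (cong (N +_) (*-distribˡ-∸ 2 q M)) (m+[n∸m]≡n (*-monoʳ-≤ 2 M≤q))))

  dual⊆transversal : ∀ {S} → IsDualMutualVisibility Adj S → S ⊆ transversal (choiceOf S)
  dual⊆transversal {S} dual {x} x∈S with position x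
  ... | internal s h 1≤h h<N x≡ = ⊥-elim (DualSet.internal∉S dual s 1≤h h<N x≡ x∈S)
  ... | leaf l N≤l l<2N x≡ = lookupℕ≡true⇒∈ (begin
    lookupℕ (transversal f) (toℕ x)    ≡⟨ lookupℕ-transversal f x ⟩
    chosenLabel f (toℕ x)              ≡⟨ cong (chosenLabel f) x≡ ⟩
    chosenLabel f (l ∸ 1)              ≡⟨ chosenLabel-leaf f N≤l ⟩
    interleave f (l ∸ N)               ≡⟨ chosen (proj₂ (parentOf l)) ⟩
    true                               ∎)
    where
    open ≡-Reasoning
    f = choiceOf S
    -- a left leaf in S forces its right sibling out of S
    chosen : ∀ {q} → Parent q l → interleave f (l ∸ N) ≡ true
    chosen {q} (right refl) = begin
      interleave f (2 * q + 1 ∸ N)   ≡⟨ proj₂ (interleave-pair f M≤q q<N) ⟩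
      lookupℕ f (q ∸ M)              ≡⟨ lookupℕ-choiceOf S M≤q q<N ⟩
      lookupℕ S (2 * q)              ≡⟨ cong (lookupℕ S) (trans (sym (m+n∸n≡m (2 * q) 1)) (sym x≡)) ⟩
      lookupℕ S (toℕ x)              ≡⟨ ∈⇒lookupℕ≡true x∈S ⟩
      true                           ∎
      where
      M≤q = Parent-≥⁻ {b = M} (right refl) N≤l
      q<N = parent<N (right refl) l<2N
    chosen {q} (left refl) = trans (proj₁ (interleave-pair f M≤q q<N))
                                   (cong not (trans (lookupℕ-choiceOf S M≤q q<N) right∉S))
      where
      M≤q = Parent-≥⁻ {b = M} (left refl) N≤l
      q<N = parent<N (left refl) l<2N
      qc : Parent q (2 * q + 1)
      qc = right refl
      z = vertex A (2 * q + 1) (N≤⇒1≤ (Parent-≥ M≤q qc)) (child<2N q<N qc)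
      z≡ = toℕ-vertex A (2 * q + 1) (N≤⇒1≤ (Parent-≥ M≤q qc)) (child<2N q<N qc)
      right∉S : lookupℕ S (2 * q) ≡ false
      right∉S with lookupℕ S (2 * q) in e
      ... | false = refl
      ... | true = ⊥-elim (DualSet.leaf-siblings-not-both∈S dual M≤q q<N x≡ z≡ x∈S
                     (lookupℕ≡true⇒∈ (trans (cong (lookupℕ S) (trans z≡ (m+n∸n≡m (2 * q) 1))) e)))

mainTheorem5 : (r : ℕ) → 2 ≤ r →
    IsMaxSize (IsTotalMutualVisibility (GTAdj r)) (2 ^ (r ∸ 1)) ×
    IsMaxSize (IsDualMutualVisibility (GTAdj r)) (2 ^ (r ∸ 1)) ×
    HasCount (IsMaxSet (IsTotalMutualVisibility (GTAdj r))) (2 ^ (2 ^ (r ∸ 1))) ×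
    HasCount (IsMaxSet (IsDualMutualVisibility (GTAdj r))) (2 ^ (2 ^ (r ∸ 1)))
mainTheorem5 (suc zero) (s≤s ())
mainTheorem5 (suc (suc k)) _ = Total.isMaxSize , Dual.isMaxSize , Total.maxSetCount , Dual.maxSetCount
  where
  open GluedTree k
  open WalkProperties Adj
  module Total = MaximumSets (IsTotalMutualVisibility Adj) transversal transversal-injective
    transversal-total ∣transversal∣≡M (λ S total → choiceOf S , dual⊆transversal (total⇒dual total))
  module Dual = MaximumSets (IsDualMutualVisibility Adj) transversal transversal-injective
    (total⇒dual ∘ transversal-total) ∣transversal∣≡M (λ S dual → choiceOf S , dual⊆transversal dual)
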